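{- The generating series $SC_2(x)=\sum_{n\ge0} sc_2(\mathcal{D}_n)x^n$ of the numbers $sc_2(\mathcal{D}_n)$ of saturated chains of length 2 in the Dyck lattices $\mathcal{D}_n$ is $$SC_2(x)=\frac{1-6x+6x^2-(1-4x)\sqrt{1-4x}}{ -(1-4x)\sqrt{1-4x}},$$ and for $n\ge1$, $$sc_2(\mathcal{D}_n)=\binom{2n}{n}\frac{(n-1)(n-2)}{2(2n-1)}.$$
   Context: A Dyck path of semilength $n$ is a word in $u$ (step $(1,1)$) and $d$ (step $(1,-1)$) with $n$ of each letter whose path from the origin never goes below the $x$-axis. $\mathcal{D}_n$ is the set of such paths ordered by $\gamma\le\gamma'$ iff $\gamma$ lies weakly below $\gamma'$ (pointwise). A saturated chain of length $h$ is a chain $\gamma^{(0)}<\cdots<\gamma^{(h)}$ where each element covers the previous one. -}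

module Defs where

open import Data.Bool using (Bool; true; false)
import Data.Bool.Properties as BoolP
open import Data.Nat using (ℕ; zero; suc; _*_)
import Data.Nat as N
open import Data.Integer using (ℤ; +_; -[1+_]; _+_; _-_; 0ℤ; 1ℤ; -1ℤ)
import Data.Integer as Z
open import Data.List using (List; []; _∷_; map; concatMap; filter; length; upTo)
open import Data.List.Properties using (≡-dec)
open import Data.List.Relation.Unary.All using (All; all?)
open import Data.List.Relation.Binary.Pointwise using (Pointwise)
import Data.List.Relation.Binary.Pointwise as PW
open import Data.Product using (_×_; _,_)
open import Relation.Nullary using (Dec; yes; no; ¬_; _×-dec_; ¬?)
open import Relation.Binary.PropositionalEquality using (_≡_; _≢_)
import Data.Nat.Properties as NP

-- Dyck paths: words in u (= true) and d (= false).

Word : Set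
Word = List Bool

step : Bool → ℤ
step true  = 1ℤ
step false = -1ℤ

heights : ℤ → Word → List ℤ
heights h []      = []
heights h (b ∷ w) = (h + step b) ∷ heights (h + step b) w

countU : Word → ℕ
countU []          = 0
countU (true ∷ w)  = suc (countU w)
countU (false ∷ w) = countU w

countD : Word → ℕ
countD []          = 0
countD (true ∷ w)  = countD w
countD (false ∷ w) = suc (countD w)

IsDyck : ℕ → Word → Set
IsDyck n w = (countU w ≡ n × countD w ≡ n) × All (λ h → 0ℤ Z.≤ h) (heights 0ℤ w)

isDyck? : ∀ n w → Dec (IsDyck n w)
isDyck? n w = ((countU w NP.≟ n) ×-dec (countD w NP.≟ n))
              ×-dec all? (λ h → 0ℤ Z.≤? h) (heights 0ℤ w)

words : ℕ → List Word
words zero    = [] ∷ []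
words (suc m) = concatMap (λ w → (true ∷ w) ∷ (false ∷ w) ∷ []) (words m)

dyck : ℕ → List Word
dyck n = filter (isDyck? n) (words (2 * n))

_≤D_ : Word → Word → Set
a ≤D b = Pointwise Z._≤_ (heights 0ℤ a) (heights 0ℤ b)

_≤D?_ : ∀ a b → Dec (a ≤D b)
a ≤D? b = PW.decidable Z._≤?_ (heights 0ℤ a) (heights 0ℤ b)

_<D_ : Word → Word → Set
a <D b = a ≤D b × a ≢ b

_<D?_ : ∀ a b → Dec (a <D b)
a <D? b = (a ≤D? b) ×-dec ¬? (≡-dec BoolP._≟_ a b)

Covers : ℕ → Word → Word → Set
Covers n a b = a <D b × All (λ c → ¬ (a <D c × c <D b)) (dyck n)

covers? : ∀ n a b → Dec (Covers n a b)
covers? n a b = (a <D? b) ×-dec all? (λ c → ¬? ((a <D? c) ×-dec (c <D? b))) (dyck n)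

Sat2 : ℕ → Word × Word × Word → Set
Sat2 n (a , b , c) = Covers n a b × Covers n b c

sat2? : ∀ n t → Dec (Sat2 n t)
sat2? n (a , b , c) = covers? n a b ×-dec covers? n b c

triples : ℕ → List (Word × Word × Word)
triples n = concatMap (λ a → concatMap (λ b → map (λ c → a , b , c) (dyck n)) (dyck n)) (dyck n)

sc2 : ℕ → ℕ
sc2 n = length (filter (sat2? n) (triples n))

Series : Set
Series = ℕ → ℤ

sumℤ : List ℤ → ℤ
sumℤ []       = 0ℤ
sumℤ (x ∷ xs) = x + sumℤ xs

_⋆_ : Series → Series → Series
(f ⋆ g) k = sumℤ (map (λ i → f i Z.* g (k N.∸ i)) (upTo (suc k)))

_⊖_ : Series → Series → Series
(f ⊖ g) k = f k - g k

-- polynomial with the given coefficient list (constant term first)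
poly : List ℤ → Series
poly []       k       = 0ℤ
poly (c ∷ cs) zero    = c
poly (c ∷ cs) (suc k) = poly cs k

SC2 : Series
SC2 n = + sc2 n

IsSqrt1-4x : Series → Set
IsSqrt1-4x s = s 0 ≡ 1ℤ × (∀ k → (s ⋆ s) k ≡ poly (1ℤ ∷ Z.- (+ 4) ∷ []) k)

-- The upper covers of a Dyck path a are exactly the paths obtained by turning one valley du of a into
-- a peak ud, so sc₂(𝒟ₙ) = Σ_a Σ_{b ∈ flips a} val b, where val counts valleys. Flipping a valley
-- changes the valley count only locally, giving Σ_{b ∈ flips a} val b + val a = val a² + #ddu a + #duu a.
-- The first-return decomposition u A d B turns the sums of these statistics over 𝒟ₙ into polynomial
-- equations in x and the Catalan series C. Eliminating all auxiliary series in the ring of formal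
-- power series, with √(1-4x) = 1 - 2xC, yields the generating function, i.e.
-- SC₂ = 1 - (1 - 6x + 6x²)(1-4x)^(-3/2); the closed form then follows from
-- [xⁿ](1-4x)^(-3/2) = (2n+1) C(2n,n) and the recurrence of central binomial coefficients.
module Submission where

module PowerSeries where

  open import Defs
  open import Data.Nat as N using (ℕ; zero; suc)
  open import Data.Integer as Z using (ℤ; +_; 0ℤ; 1ℤ)
  import Data.Integer.Properties as ZP
  open import Data.List using ([]; _∷_; map; applyUpTo)
  open import Relation.Binary.PropositionalEquality
  open import Function using (_∘_; id)
  open import Data.Integer.Tactic.RingSolver using (solve-∀)

  infix 4 _≐_
  _≐_ : Series → Series → Set
  f ≐ g = ∀ k → f k ≡ g k

  infixl 6 _⊕_
  _⊕_ : Series → Series → Series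
  (f ⊕ g) k = f k Z.+ g k

  neg : Series → Series
  neg f k = Z.- f k

  𝟘 : Series
  𝟘 _ = 0ℤ

  κ : ℤ → Series
  κ c = poly (c ∷ [])

  𝟙 : Series
  𝟙 = κ 1ℤ

  shift : Series → Series
  shift f k = f (suc k)

  scale : ℤ → Series → Series
  scale c f k = c Z.* f k

  sumTo : ℕ → (ℕ → ℤ) → ℤ
  sumTo zero F = 0ℤ
  sumTo (suc n) F = F 0 Z.+ sumTo n (F ∘ suc)

  sum-apply : ∀ (F : ℕ → ℤ) g n → sumℤ (map F (applyUpTo g n)) ≡ sumTo n (F ∘ g)
  sum-apply F g zero = refl
  sum-apply F g (suc n) = cong (Z._+_ (F (g 0))) (sum-apply F (g ∘ suc) n)

  ⋆-suc : ∀ f g k → (f ⋆ g) (suc k) ≡ f 0 Z.* g (suc k) Z.+ (shift f ⋆ g) k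
  ⋆-suc f g k = cong (Z._+_ (f 0 Z.* g (suc k)))
    (trans (sum-apply (λ i → f i Z.* g (suc k N.∸ i)) suc (suc k))
           (sym (sum-apply (λ i → f (suc i) Z.* g (k N.∸ i)) id (suc k))))

  ⋆-cong : ∀ {f f' g g'} → f ≐ f' → g ≐ g' → f ⋆ g ≐ f' ⋆ g'
  ⋆-cong {f} {f'} {g} {g'} p q zero = cong₂ (λ a b → a Z.* b Z.+ 0ℤ) (p 0) (q 0)
  ⋆-cong {f} {f'} {g} {g'} p q (suc k) =
    trans (⋆-suc f g k) (trans (cong₂ Z._+_ (cong₂ Z._*_ (p 0) (q (suc k)))
      (⋆-cong {shift f} {shift f'} (λ j → p (suc j)) q k)) (sym (⋆-suc f' g' k)))

  ⋆-zeroˡ : ∀ g → 𝟘 ⋆ g ≐ 𝟘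
  ⋆-zeroˡ g zero = refl
  ⋆-zeroˡ g (suc k) = trans (⋆-suc 𝟘 g k) (trans (ZP.+-identityˡ _) (⋆-zeroˡ g k))

  ⋆-identityˡ : ∀ g → 𝟙 ⋆ g ≐ g
  ⋆-identityˡ g zero = trans (ZP.+-identityʳ _) (ZP.*-identityˡ _)
  ⋆-identityˡ g (suc k) = trans (⋆-suc 𝟙 g k)
    (trans (cong₂ Z._+_ (ZP.*-identityˡ (g (suc k))) (⋆-zeroˡ g k)) (ZP.+-identityʳ _))

  ⋆-distribʳ : ∀ f g h → (f ⊕ g) ⋆ h ≐ (f ⋆ h) ⊕ (g ⋆ h)
  ⋆-distribʳ f g h zero = lem (f 0) (g 0) (h 0)
    where
    lem : ∀ a b c → (a Z.+ b) Z.* c Z.+ 0ℤ ≡ (a Z.* c Z.+ 0ℤ) Z.+ (b Z.* c Z.+ 0ℤ)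
    lem = solve-∀
  ⋆-distribʳ f g h (suc k) =
    trans (⋆-suc (f ⊕ g) h k)
    (trans (cong (Z._+_ ((f 0 Z.+ g 0) Z.* h (suc k))) (⋆-distribʳ (shift f) (shift g) h k))
    (trans (lem (f 0) (g 0) (h (suc k)) ((shift f ⋆ h) k) ((shift g ⋆ h) k))
     (sym (cong₂ Z._+_ (⋆-suc f h k) (⋆-suc g h k)))))
    where
    lem : ∀ a b c x y → (a Z.+ b) Z.* c Z.+ (x Z.+ y) ≡ (a Z.* c Z.+ x) Z.+ (b Z.* c Z.+ y)
    lem = solve-∀

  ⋆-scaleˡ : ∀ c f h → scale c f ⋆ h ≐ scale c (f ⋆ h)
  ⋆-scaleˡ c f h zero = lem c (f 0) (h 0)
    where
    lem : ∀ c a b → c Z.* a Z.* b Z.+ 0ℤ ≡ c Z.* (a Z.* b Z.+ 0ℤ)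
    lem = solve-∀
  ⋆-scaleˡ c f h (suc k) =
    trans (⋆-suc (scale c f) h k)
    (trans (cong (Z._+_ (c Z.* f 0 Z.* h (suc k))) (⋆-scaleˡ c (shift f) h k))
    (trans (lem c (f 0) (h (suc k)) ((shift f ⋆ h) k)) (sym (cong (c Z.*_) (⋆-suc f h k)))))
    where
    lem : ∀ c a b x → c Z.* a Z.* b Z.+ c Z.* x ≡ c Z.* (a Z.* b Z.+ x)
    lem = solve-∀

  ⋆-comm : ∀ f g → f ⋆ g ≐ g ⋆ f
  ⋆-comm f g zero = cong (λ z → z Z.+ 0ℤ) (ZP.*-comm (f 0) (g 0))
  ⋆-comm f g (suc zero) = trans (⋆-suc f g 0) (trans (lem (f 0) (g 1) (f 1) (g 0)) (sym (⋆-suc g f 0)))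
    where
    lem : ∀ a b c d → a Z.* b Z.+ (c Z.* d Z.+ 0ℤ) ≡ d Z.* c Z.+ (b Z.* a Z.+ 0ℤ)
    lem = solve-∀
  ⋆-comm f g (suc (suc k)) =
    trans (⋆-suc f g (suc k))
    (trans (cong (Z._+_ (f 0 Z.* g (suc (suc k)))) (trans (⋆-comm (shift f) g (suc k)) (⋆-suc g (shift f) k)))
    (trans (cong (λ z → f 0 Z.* g (suc (suc k)) Z.+ (g 0 Z.* f (suc (suc k)) Z.+ z)) (⋆-comm (shift g) (shift f) k))
    (trans (lem (f 0) (g (suc (suc k))) (g 0) (f (suc (suc k))) ((shift f ⋆ shift g) k))
    (sym (trans (⋆-suc g f (suc k))
    (cong (Z._+_ (g 0 Z.* f (suc (suc k)))) (trans (⋆-comm (shift g) f (suc k)) (⋆-suc f (shift g) k))))))))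
    where
    lem : ∀ a b c d x → a Z.* b Z.+ (c Z.* d Z.+ x) ≡ c Z.* d Z.+ (a Z.* b Z.+ x)
    lem = solve-∀

  ⋆-assoc : ∀ f g h → (f ⋆ g) ⋆ h ≐ f ⋆ (g ⋆ h)
  ⋆-assoc f g h zero = lem (f 0) (g 0) (h 0)
    where
    lem : ∀ a b c → (a Z.* b Z.+ 0ℤ) Z.* c Z.+ 0ℤ ≡ a Z.* (b Z.* c Z.+ 0ℤ) Z.+ 0ℤ
    lem = solve-∀
  ⋆-assoc f g h (suc k) =
    trans (⋆-suc (f ⋆ g) h k)
    (trans (cong (Z._+_ ((f ⋆ g) 0 Z.* h (suc k)))
       (trans (⋆-cong {shift (f ⋆ g)} {_} {h} {h} (⋆-suc f g) (λ _ → refl) k)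
       (trans (⋆-distribʳ (scale (f 0) (shift g)) (shift f ⋆ g) h k)
       (cong₂ Z._+_ (⋆-scaleˡ (f 0) (shift g) h k) (⋆-assoc (shift f) g h k)))))
    (trans (lem (f 0) (g 0) (h (suc k)) ((shift g ⋆ h) k) ((shift f ⋆ (g ⋆ h)) k))
    (sym (trans (⋆-suc f (g ⋆ h) k) (cong (λ z → f 0 Z.* z Z.+ (shift f ⋆ (g ⋆ h)) k) (⋆-suc g h k))))))
    where
    lem : ∀ a b c x y → (a Z.* b Z.+ 0ℤ) Z.* c Z.+ (a Z.* x Z.+ y) ≡ a Z.* (b Z.* c Z.+ x) Z.+ y
    lem = solve-∀


module PowerSeriesRing where

  open import Defs
  open PowerSeries
  open import Data.Nat as N using (zero; suc)
  open import Data.Integer as Z using (0ℤ; 1ℤ)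
  import Data.Integer.Properties as ZP
  import Data.Nat.Properties as NP
  open import Data.List using (List; []; _∷_)
  open import Data.List.Relation.Unary.All using (All; []; _∷_)
  open import Data.Vec using (Vec)
  open import Data.Product using (_×_; _,_; proj₂)
  open import Data.Sum using (inj₁; inj₂)
  open import Data.Maybe using (Maybe; just; nothing)
  open import Relation.Nullary using (yes; no)
  open import Relation.Binary.PropositionalEquality as P using (_≡_; refl; cong; cong₂)
  open import Algebra.Structures using (IsCommutativeRing)
  open import Algebra.Bundles using (CommutativeRing)
  import Algebra.Solver.Ring.AlmostCommutativeRing as ACR
  open import Level using (0ℓ)

  ⋆-distribˡ : ∀ f g h → f ⋆ (g ⊕ h) ≐ (f ⋆ g) ⊕ (f ⋆ h)
  ⋆-distribˡ f g h k = P.trans (⋆-comm f (g ⊕ h) k)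
    (P.trans (⋆-distribʳ g h f k) (cong₂ Z._+_ (⋆-comm g f k) (⋆-comm h f k)))

  ⋆-identityʳ : ∀ g → g ⋆ 𝟙 ≐ g
  ⋆-identityʳ g k = P.trans (⋆-comm g 𝟙 k) (⋆-identityˡ g k)

  -- A record rather than a bare Π-type, so that both series can be inferred from a proof.
  infix 4 _≈_
  record _≈_ (f g : Series) : Set where
    constructor mk
    field at : f ≐ g
  open _≈_ public

  ⋆-isCommutativeRing : IsCommutativeRing _≈_ _⊕_ _⋆_ neg 𝟘 𝟙
  ⋆-isCommutativeRing = record
    { isRing = record
      { +-isAbelianGroup = record
        { isGroup = record
          { isMonoid = record
            { isSemigroup = record
              { isMagma = record
                { isEquivalence = record
                  { refl = mk (λ _ → refl)
                  ; sym = λ p → mk (λ k → P.sym (at p k))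
                  ; trans = λ p q → mk (λ k → P.trans (at p k) (at q k)) }
                ; ∙-cong = λ p q → mk (λ k → cong₂ Z._+_ (at p k) (at q k)) }
              ; assoc = λ f g h → mk (λ k → ZP.+-assoc (f k) (g k) (h k)) }
            ; identity = (λ f → mk (λ k → ZP.+-identityˡ (f k))) , (λ f → mk (λ k → ZP.+-identityʳ (f k))) }
          ; inverse = (λ f → mk (λ k → ZP.+-inverseˡ (f k))) , (λ f → mk (λ k → ZP.+-inverseʳ (f k)))
          ; ⁻¹-cong = λ p → mk (λ k → cong Z.-_ (at p k)) }
        ; comm = λ f g → mk (λ k → ZP.+-comm (f k) (g k)) }
      ; *-cong = λ {f} {f'} {g} {g'} p q → mk (⋆-cong {f} {f'} {g} {g'} (at p) (at q))
      ; *-assoc = λ f g h → mk (⋆-assoc f g h)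
      ; *-identity = (λ f → mk (⋆-identityˡ f)) , (λ f → mk (⋆-identityʳ f))
      ; distrib = (λ f g h → mk (⋆-distribˡ f g h)) , (λ h f g → mk (⋆-distribʳ f g h))
      }
    ; *-comm = λ f g → mk (⋆-comm f g)
    }

  seriesRing : CommutativeRing 0ℓ 0ℓ
  seriesRing = record { isCommutativeRing = ⋆-isCommutativeRing }

  open CommutativeRing seriesRing public using (setoid)
    renaming (refl to ≈refl; sym to ≈sym; trans to ≈trans)
  open import Relation.Binary.Reasoning.Setoid setoid

  ⊕-cong : ∀ f f' g g' → f ≈ f' → g ≈ g' → f ⊕ g ≈ f' ⊕ g'
  ⊕-cong f f' g g' p q = mk (λ k → cong₂ Z._+_ (at p k) (at q k))

  ⋆-cong≈ : ∀ f f' g g' → f ≈ f' → g ≈ g' → f ⋆ g ≈ f' ⋆ g'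
  ⋆-cong≈ f f' g g' p q = mk (⋆-cong {f} {f'} {g} {g'} (at p) (at q))

  ⋆-zeroʳ : ∀ f → f ⋆ 𝟘 ≈ 𝟘
  ⋆-zeroʳ f = mk (λ k → P.trans (⋆-comm f 𝟘 k) (⋆-zeroˡ f k))

  κ-* : ∀ a b → κ (a Z.* b) ≐ κ a ⋆ κ b
  κ-* a b zero = P.sym (ZP.+-identityʳ _)
  κ-* a b (suc k) = P.sym (P.trans (⋆-suc (κ a) (κ b) k)
     (cong₂ Z._+_ (ZP.*-zeroʳ a) (⋆-zeroˡ (κ b) k)))

  κ⋆ : ∀ b h → κ b ⋆ h ≐ scale b h
  κ⋆ b h zero = ZP.+-identityʳ _
  κ⋆ b h (suc k) = P.trans (⋆-suc (κ b) h k)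
    (P.trans (cong (Z._+_ (b Z.* h (suc k))) (⋆-zeroˡ h k)) (ZP.+-identityʳ _))

  κ-homomorphism : ACR._-Raw-AlmostCommutative⟶_ Z.+-*-rawRing (ACR.fromCommutativeRing seriesRing)
  κ-homomorphism = record
    { ⟦_⟧ = κ
    ; +-homo = λ a b → mk λ { zero → refl ; (suc k) → refl }
    ; *-homo = λ a b → mk (κ-* a b)
    ; -‿homo = λ a → mk λ { zero → refl ; (suc k) → refl }
    ; 0-homo = mk λ { zero → refl ; (suc k) → refl }
    ; 1-homo = mk λ { zero → refl ; (suc k) → refl }
    }

  κ-≟ : ∀ a b → Maybe (κ a ≈ κ b)
  κ-≟ a b with a ZP.≟ b
  ... | yes p = just (mk (λ k → cong (λ c → κ c k) p))
  ... | no _ = nothing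

  open import Algebra.Solver.Ring Z.+-*-rawRing (ACR.fromCommutativeRing seriesRing) κ-homomorphism κ-≟ public
    using (solve; _:=_; con; _:+_; _:*_; _:-_; :-_; _:^_; Polynomial; prove; ⟦_⟧; ⟦_⟧↓; var)

  κ0 : κ 0ℤ ≈ 𝟘
  κ0 = mk λ { zero → refl ; (suc k) → refl }

  ≈-by-difference : ∀ f g → f ⊕ neg g ≈ 𝟘 → f ≈ g
  ≈-by-difference f g p = mk (λ k → ZP.i-j≡0⇒i≡j (f k) (g k) (at p k))

  ≈⇒difference≈𝟘 : ∀ f g → f ≈ g → f ⊕ neg g ≈ 𝟘
  ≈⇒difference≈𝟘 f g p = mk (λ k → P.trans (cong (λ z → z Z.+ Z.- g k) (at p k)) (ZP.+-inverseʳ (g k)))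

  ⋆-zero-prefix : ∀ (h f : Series) m → (∀ j → j N.≤ m → f j ≡ 0ℤ) → (h ⋆ f) m ≡ 0ℤ
  ⋆-zero-prefix h f zero p = P.trans (cong (λ z → h 0 Z.* z Z.+ 0ℤ) (p 0 N.z≤n)) (cong (Z._+ 0ℤ) (ZP.*-zeroʳ (h 0)))
  ⋆-zero-prefix h f (suc m) p = P.trans (⋆-suc h f m)
    (cong₂ Z._+_ (P.trans (cong (h 0 Z.*_) (p (suc m) NP.≤-refl)) (ZP.*-zeroʳ (h 0)))
                 (⋆-zero-prefix (shift h) f m (λ j q → p j (NP.m≤n⇒m≤1+n q))))

  ⋆-cancel : ∀ f g c → g 0 ≡ c → (∀ x → c Z.* x ≡ 0ℤ → x ≡ 0ℤ) → f ⋆ g ≈ 𝟘 → f ≈ 𝟘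
  ⋆-cancel f g c g0 regular e = mk (λ k → upTo k k NP.≤-refl)
    where
    g⋆f≐𝟘 : ∀ k → (g ⋆ f) k ≡ 0ℤ
    g⋆f≐𝟘 k = P.trans (⋆-comm g f k) (at e k)
    upTo : ∀ k j → j N.≤ k → f j ≡ 0ℤ
    upTo zero .zero N.z≤n = regular (f 0) (P.trans (cong (λ z → z Z.* f 0) (P.sym g0))
          (P.trans (P.sym (ZP.+-identityʳ _)) (g⋆f≐𝟘 0)))
    upTo (suc k) j p with NP.m≤n⇒m<n∨m≡n p
    ... | inj₁ (N.s≤s q) = upTo k j q
    ... | inj₂ refl = regular (f (suc k)) (P.trans (cong (λ z → z Z.* f (suc k)) (P.sym g0))
          (P.trans (P.sym (ZP.+-identityʳ _))
          (P.trans (cong (Z._+_ (g 0 Z.* f (suc k))) (P.sym (⋆-zero-prefix (shift g) f k (upTo k))))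
          (P.trans (P.sym (⋆-suc g f k)) (g⋆f≐𝟘 (suc k))))))

  X : Series
  X = poly (0ℤ ∷ 1ℤ ∷ [])

  X⋆-suc : ∀ G n → (X ⋆ G) (suc n) ≡ G n
  X⋆-suc G n = P.trans (⋆-suc X G n)
    (P.trans (cong (λ z → 0ℤ Z.* G (suc n) Z.+ z) (κ⋆ 1ℤ G n)) (P.trans (ZP.+-identityˡ _) (ZP.*-identityˡ (G n))))

  ≈X⋆ : ∀ F G → F 0 ≡ 0ℤ → (∀ n → F (suc n) ≡ G n) → F ≈ X ⋆ G
  ≈X⋆ F G e0 es = mk λ { zero → e0 ; (suc n) → P.trans (es n) (P.sym (X⋆-suc G n)) }

  ≈κ⊕X⋆ : ∀ F G c → F 0 ≡ c → (∀ n → F (suc n) ≡ G n) → F ≈ κ c ⊕ X ⋆ G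
  ≈κ⊕X⋆ F G c e0 es = mk λ
    { zero → P.trans e0 (P.sym (ZP.+-identityʳ c))
    ; (suc n) → P.trans (es n) (P.sym (P.trans (ZP.+-identityˡ ((X ⋆ G) (suc n))) (X⋆-suc G n))) }

  -- lhs ≈ rhs is certified by writing lhs - rhs as Σ cᵢ zᵢ with relations zᵢ ≈ 𝟘.
  combination : ∀ {m} → List (Polynomial m × Polynomial m) → Polynomial m
  combination [] = con 0ℤ
  combination ((c , z) ∷ L) = c :* z :+ combination L

  combination≈𝟘 : ∀ {m} (ρ : Vec Series m) L → All (λ p → ⟦ proj₂ p ⟧ ρ ≈ 𝟘) L → ⟦ combination L ⟧ ρ ≈ 𝟘
  combination≈𝟘 ρ [] [] = κ0
  combination≈𝟘 ρ ((c , z) ∷ L) (p ∷ ps) = begin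
    ⟦ c ⟧ ρ ⋆ ⟦ z ⟧ ρ ⊕ ⟦ combination L ⟧ ρ
      ≈⟨ ⊕-cong _ _ _ _ (⋆-cong≈ (⟦ c ⟧ ρ) (⟦ c ⟧ ρ) (⟦ z ⟧ ρ) 𝟘 ≈refl p) (combination≈𝟘 ρ L ps) ⟩
    ⟦ c ⟧ ρ ⋆ 𝟘 ⊕ 𝟘 ≈⟨ mk (λ k → P.trans (ZP.+-identityʳ _) (at (⋆-zeroʳ (⟦ c ⟧ ρ)) k)) ⟩
    𝟘 ∎

  ≈-modulo : ∀ {m} (ρ : Vec Series m) lhs rhs L → ⟦ lhs ⟧↓ ρ ≈ ⟦ rhs :+ combination L ⟧↓ ρ →
    All (λ p → ⟦ proj₂ p ⟧ ρ ≈ 𝟘) L → ⟦ lhs ⟧ ρ ≈ ⟦ rhs ⟧ ρ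
  ≈-modulo ρ lhs rhs L normal relations = begin
    ⟦ lhs ⟧ ρ ≈⟨ prove ρ lhs (rhs :+ combination L) normal ⟩
    ⟦ rhs ⟧ ρ ⊕ ⟦ combination L ⟧ ρ ≈⟨ ⊕-cong (⟦ rhs ⟧ ρ) (⟦ rhs ⟧ ρ) _ 𝟘 ≈refl (combination≈𝟘 ρ L relations) ⟩
    ⟦ rhs ⟧ ρ ⊕ 𝟘 ≈⟨ mk (λ k → ZP.+-identityʳ _) ⟩
    ⟦ rhs ⟧ ρ ∎


module Derivative where

  open import Defs
  open PowerSeries
  open PowerSeriesRing
  open import Data.Nat using (zero; suc)
  open import Data.Integer as Z using (+_; 0ℤ; 1ℤ)
  open import Relation.Binary.PropositionalEquality
  open import Data.Integer.Tactic.RingSolver using (solve-∀)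

  ∂ : Series → Series
  ∂ f k = + suc k Z.* f (suc k)

  ∂-cong : ∀ {f g} → f ≐ g → ∂ f ≐ ∂ g
  ∂-cong p k = cong (λ z → + suc k Z.* z) (p (suc k))

  shift-∂ : ∀ f → shift (∂ f) ≐ ∂ (shift f) ⊕ shift (shift f)
  shift-∂ f k = lem (+ suc k) (f (suc (suc k)))
    where
    lem : ∀ a x → (1ℤ Z.+ a) Z.* x ≡ a Z.* x Z.+ x
    lem = solve-∀

  ∂-⋆ : ∀ f g → ∂ (f ⋆ g) ≐ (∂ f ⋆ g) ⊕ (f ⋆ ∂ g)
  ∂-⋆ f g zero = trans (cong (λ z → 1ℤ Z.* z) (⋆-suc f g 0)) (lem (f 0) (g 1) (f 1) (g 0))
    where
    lem : ∀ a b c d → 1ℤ Z.* (a Z.* b Z.+ (c Z.* d Z.+ 0ℤ)) ≡ (1ℤ Z.* c Z.* d Z.+ 0ℤ) Z.+ (a Z.* (1ℤ Z.* b) Z.+ 0ℤ)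
    lem = solve-∀
  ∂-⋆ f g (suc k) =
    trans (cong (λ z → + suc (suc k) Z.* z) (⋆-suc f g (suc k)))
    (trans (regroup (f 0) (g (suc (suc k))) (+ suc k) ((shift f ⋆ g) (suc k)) (f 1) (g (suc k))
                ((shift (shift f) ⋆ g) k) ((∂ (shift f) ⋆ g) k) ((shift f ⋆ ∂ g) k)
                (⋆-suc (shift f) g k) (∂-⋆ (shift f) g k))
    (sym (cong₂ Z._+_
       (trans (⋆-suc (∂ f) g k) (cong (Z._+_ (1ℤ Z.* f 1 Z.* g (suc k)))
          (trans (⋆-cong {shift (∂ f)} {_} {g} {g} (shift-∂ f) (λ _ → refl) k) (⋆-distribʳ (∂ (shift f)) (shift (shift f)) g k))))
       (⋆-suc f (∂ g) k))))
    where
    regroup : ∀ A B K1 X f1 g1 R P S → X ≡ f1 Z.* g1 Z.+ R → K1 Z.* X ≡ P Z.+ S →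
          (1ℤ Z.+ K1) Z.* (A Z.* B Z.+ X) ≡ (1ℤ Z.* f1 Z.* g1 Z.+ (P Z.+ R)) Z.+ (A Z.* ((1ℤ Z.+ K1) Z.* B) Z.+ S)
    regroup A B K1 X f1 g1 R P S p q = trans (l A B K1 X) (trans (cong₂ (λ u v → A Z.* ((1ℤ Z.+ K1) Z.* B) Z.+ u Z.+ v) p q)
       (l2 A B K1 f1 g1 R P S))
      where
      l : ∀ A B K1 X → (1ℤ Z.+ K1) Z.* (A Z.* B Z.+ X) ≡ A Z.* ((1ℤ Z.+ K1) Z.* B) Z.+ X Z.+ K1 Z.* X
      l = solve-∀
      l2 : ∀ A B K1 f1 g1 R P S → A Z.* ((1ℤ Z.+ K1) Z.* B) Z.+ (f1 Z.* g1 Z.+ R) Z.+ (P Z.+ S) ≡ (1ℤ Z.* f1 Z.* g1 Z.+ (P Z.+ R)) Z.+ (A Z.* ((1ℤ Z.+ K1) Z.* B) Z.+ S)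
      l2 = solve-∀


module SquareRoot where

  open import Defs
  open PowerSeries
  open PowerSeriesRing
  open Derivative
  open import Data.Nat using (zero; suc)
  open import Data.Integer as Z using (+_; 0ℤ; 1ℤ)
  import Data.Integer.Properties as ZP
  open import Data.List using ([]; _∷_)
  open import Relation.Binary.PropositionalEquality as P using (_≡_; refl; cong)
  open import Data.Product using (_,_)
  open import Relation.Binary.Reasoning.Setoid setoid

  Q : Series
  Q = poly (1ℤ ∷ Z.- (+ 4) ∷ [])

  ∂Q : ∂ Q ≈ κ (Z.- (+ 4))
  ∂Q = mk λ { zero → refl ; (suc k) → ZP.*-zeroʳ (+ suc (suc k)) }

  regular-2 : ∀ x → + 2 Z.* x ≡ 0ℤ → x ≡ 0ℤ
  regular-2 x p = ZP.*-cancelˡ-≡ (+ 2) x 0ℤ (P.trans p (P.sym (ZP.*-zeroʳ (+ 2))))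
  regular-1 : ∀ x → 1ℤ Z.* x ≡ 0ℤ → x ≡ 0ℤ
  regular-1 x p = P.trans (P.sym (ZP.*-identityˡ x)) p

  -- For s = √(1-4x) one has s s' = -2, so V = (1-4x) s solves (1-4x) V' = -6 V; a solution h of
  -- (1-4x) h' = 6 h with h(0) = 1 is then the inverse of V, because (1-4x) (hV)' = 0.
  module Root (s : Series) (s0 : s 0 ≡ 1ℤ) (ss : s ⋆ s ≈ Q) where

    s∂s : Series
    s∂s = s ⋆ ∂ s

    double-s∂s : κ (+ 2) ⋆ s∂s ≈ κ (Z.- (+ 4))
    double-s∂s = begin
      κ (+ 2) ⋆ s∂s ≈⟨ solve 2 (λ a b → con (+ 2) :* (a :* b) := b :* a :+ a :* b) ≈refl s (∂ s) ⟩
      (∂ s ⋆ s) ⊕ (s ⋆ ∂ s) ≈⟨ ≈sym (mk (∂-⋆ s s)) ⟩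
      ∂ (s ⋆ s) ≈⟨ mk (∂-cong (at ss)) ⟩
      ∂ Q ≈⟨ ∂Q ⟩
      κ (Z.- (+ 4)) ∎

    s∂s-value : s∂s ≈ κ (Z.- (+ 2))
    s∂s-value = ≈-by-difference s∂s (κ (Z.- (+ 2))) (⋆-cancel (s∂s ⊕ neg (κ (Z.- (+ 2)))) (κ (+ 2)) (+ 2) refl regular-2 (begin
      (s∂s ⊕ neg (κ (Z.- (+ 2)))) ⋆ κ (+ 2) ≈⟨ solve 1 (λ e → (e :- con (Z.- (+ 2))) :* con (+ 2) := con (+ 2) :* e :+ con (+ 4)) ≈refl s∂s ⟩
      κ (+ 2) ⋆ s∂s ⊕ κ (+ 4) ≈⟨ ⊕-cong _ _ (κ (+ 4)) (κ (+ 4)) double-s∂s ≈refl ⟩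
      κ (Z.- (+ 4)) ⊕ κ (+ 4) ≈⟨ mk (λ { zero → refl ; (suc k) → refl }) ⟩
      𝟘 ∎))

    V : Series
    V = Q ⋆ s

    ∂V : ∂ V ≈ κ (Z.- (+ 6)) ⋆ s
    ∂V = begin
      ∂ (Q ⋆ s) ≈⟨ mk (∂-⋆ Q s) ⟩
      (∂ Q ⋆ s) ⊕ (Q ⋆ ∂ s) ≈⟨ ⊕-cong (∂ Q ⋆ s) (κ (Z.- (+ 4)) ⋆ s) (Q ⋆ ∂ s) ((s ⋆ s) ⋆ ∂ s) (⋆-cong≈ _ _ s s ∂Q ≈refl) (⋆-cong≈ Q (s ⋆ s) (∂ s) (∂ s) (≈sym ss) ≈refl) ⟩
      (κ (Z.- (+ 4)) ⋆ s) ⊕ ((s ⋆ s) ⋆ ∂ s) ≈⟨ ⊕-cong (κ (Z.- (+ 4)) ⋆ s) (κ (Z.- (+ 4)) ⋆ s) _ _ ≈refl (mk (⋆-assoc s s (∂ s))) ⟩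
      (κ (Z.- (+ 4)) ⋆ s) ⊕ (s ⋆ s∂s) ≈⟨ ⊕-cong (κ (Z.- (+ 4)) ⋆ s) (κ (Z.- (+ 4)) ⋆ s) (s ⋆ s∂s) (s ⋆ κ (Z.- (+ 2))) ≈refl (⋆-cong≈ s s s∂s _ ≈refl s∂s-value) ⟩
      (κ (Z.- (+ 4)) ⋆ s) ⊕ (s ⋆ κ (Z.- (+ 2))) ≈⟨ solve 1 (λ a → con (Z.- (+ 4)) :* a :+ a :* con (Z.- (+ 2)) := con (Z.- (+ 6)) :* a) ≈refl s ⟩
      κ (Z.- (+ 6)) ⋆ s ∎

    Q⋆∂V : Q ⋆ ∂ V ≈ κ (Z.- (+ 6)) ⋆ V
    Q⋆∂V = begin
      Q ⋆ ∂ V ≈⟨ ⋆-cong≈ Q Q (∂ V) _ ≈refl ∂V ⟩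
      Q ⋆ (κ (Z.- (+ 6)) ⋆ s) ≈⟨ solve 2 (λ q a → q :* (con (Z.- (+ 6)) :* a) := con (Z.- (+ 6)) :* (q :* a)) ≈refl Q s ⟩
      κ (Z.- (+ 6)) ⋆ V ∎

    module Inverse (h : Series) (h0 : h 0 ≡ 1ℤ) (Q⋆∂h : Q ⋆ ∂ h ≈ κ (+ 6) ⋆ h) where

      ∂[hV]⋆Q≈𝟘 : ∂ (h ⋆ V) ⋆ Q ≈ 𝟘
      ∂[hV]⋆Q≈𝟘 = begin
        ∂ (h ⋆ V) ⋆ Q ≈⟨ ⋆-cong≈ (∂ (h ⋆ V)) ((∂ h ⋆ V) ⊕ (h ⋆ ∂ V)) Q Q (mk (∂-⋆ h V)) ≈refl ⟩
        ((∂ h ⋆ V) ⊕ (h ⋆ ∂ V)) ⋆ Q ≈⟨ solve 5 (λ dh v h dv q → (dh :* v :+ h :* dv) :* q := (q :* dh) :* v :+ h :* (q :* dv)) ≈refl (∂ h) V h (∂ V) Q ⟩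
        ((Q ⋆ ∂ h) ⋆ V) ⊕ (h ⋆ (Q ⋆ ∂ V)) ≈⟨ ⊕-cong ((Q ⋆ ∂ h) ⋆ V) ((κ (+ 6) ⋆ h) ⋆ V) (h ⋆ (Q ⋆ ∂ V)) (h ⋆ (κ (Z.- (+ 6)) ⋆ V)) (⋆-cong≈ _ _ V V Q⋆∂h ≈refl) (⋆-cong≈ h h _ _ ≈refl Q⋆∂V) ⟩
        ((κ (+ 6) ⋆ h) ⋆ V) ⊕ (h ⋆ (κ (Z.- (+ 6)) ⋆ V)) ≈⟨ solve 2 (λ h v → (con (+ 6) :* h) :* v :+ h :* (con (Z.- (+ 6)) :* v) := con 0ℤ) ≈refl h V ⟩
        κ 0ℤ ≈⟨ κ0 ⟩
        𝟘 ∎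

      hV≐𝟙 : h ⋆ V ≐ 𝟙
      hV≐𝟙 zero = P.trans (cong (λ z → z Z.* (Q 0 Z.* s 0 Z.+ 0ℤ) Z.+ 0ℤ) h0) (cong (λ z → 1ℤ Z.* (1ℤ Z.* z Z.+ 0ℤ) Z.+ 0ℤ) s0)
      hV≐𝟙 (suc k) = ZP.*-cancelˡ-≡ (+ suc k) ((h ⋆ V) (suc k)) 0ℤ
        (P.trans (at (⋆-cancel (∂ (h ⋆ V)) Q 1ℤ refl regular-1 ∂[hV]⋆Q≈𝟘) k) (P.sym (ZP.*-zeroʳ (+ suc k))))

      hV≈𝟙 : h ⋆ V ≈ 𝟙
      hV≈𝟙 = mk hV≐𝟙


module CentralBinomial where

  open import Data.Nat
  open import Data.Nat.Properties
  open import Data.Nat.Combinatorics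
  open import Relation.Binary.PropositionalEquality
  open import Data.Nat.Tactic.RingSolver using (solve-∀)

  absorption : ∀ n k → suc k * (suc n C suc k) ≡ suc n * (n C k)
  absorption zero zero = refl
  absorption zero (suc k) = trans (cong (suc (suc k) *_) (k>n⇒nCk≡0 {1} {suc (suc k)} (s≤s (s≤s z≤n)))) (trans (*-zeroʳ (suc (suc k))) (cong (1 *_) (sym (k>n⇒nCk≡0 {0} {suc k} (s≤s z≤n)))))
  absorption (suc n) zero = trans (+-identityʳ _) (trans (nC1≡n (suc (suc n))) (sym (*-identityʳ (suc (suc n)))))
  absorption (suc n) (suc k) = begin
    suc (suc k) * (suc (suc n) C suc (suc k))
      ≡⟨ cong (suc (suc k) *_) (sym (nCk+nC[k+1]≡[n+1]C[k+1] (suc n) (suc k))) ⟩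
    suc (suc k) * (suc n C suc k + suc n C suc (suc k))
      ≡⟨ distrib₁ (suc n C suc k) (suc k) (suc n C suc (suc k)) ⟩
    suc n C suc k + suc k * (suc n C suc k) + suc (suc k) * (suc n C suc (suc k))
      ≡⟨ cong₂ (λ a b → suc n C suc k + a + b) (absorption n k) (absorption n (suc k)) ⟩
    suc n C suc k + suc n * (n C k) + suc n * (n C suc k)
      ≡⟨ distrib₂ (suc n C suc k) (suc n) (n C k) (n C suc k) ⟩
    suc n C suc k + suc n * (n C k + n C suc k)
      ≡⟨ cong (λ z → suc n C suc k + suc n * z) (nCk+nC[k+1]≡[n+1]C[k+1] n k) ⟩
    suc n C suc k + suc n * (suc n C suc k)
      ≡⟨⟩
    suc (suc n) * (suc n C suc k) ∎
    where
    open ≡-Reasoning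
    distrib₁ : ∀ a k b → suc k * (a + b) ≡ a + k * a + suc k * b
    distrib₁ = solve-∀
    distrib₂ : ∀ c m x y → c + m * x + m * y ≡ c + m * (x + y)
    distrib₂ = solve-∀

  centralBinomial-recurrence : ∀ n → suc n * ((2 * suc n) C suc n) ≡ 2 * (2 * n + 1) * ((2 * n) C n)
  centralBinomial-recurrence n = *-cancelˡ-≡ _ _ (suc n) (begin
    suc n * (suc n * ((2 * suc n) C suc n))
      ≡⟨ cong (λ z → suc n * (suc n * (z C suc n))) (double-suc n) ⟩
    suc n * (suc n * (suc (suc (2 * n)) C suc n))
      ≡⟨ cong (suc n *_) (absorption (suc (2 * n)) n) ⟩
    suc n * (suc (suc (2 * n)) * (suc (2 * n) C n))
      ≡⟨ cong (λ z → suc n * (suc (suc (2 * n)) * z)) symmetry ⟩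
    suc n * (suc (suc (2 * n)) * (suc (2 * n) C suc n))
      ≡⟨ swap (suc n) (suc (suc (2 * n))) (suc (2 * n) C suc n) ⟩
    suc (suc (2 * n)) * (suc n * (suc (2 * n) C suc n))
      ≡⟨ cong (suc (suc (2 * n)) *_) (absorption (2 * n) n) ⟩
    suc (suc (2 * n)) * (suc (2 * n) * ((2 * n) C n))
      ≡⟨ regroup n ((2 * n) C n) ⟩
    suc n * (2 * (2 * n + 1) * ((2 * n) C n)) ∎)
    where
    open ≡-Reasoning
    double-suc : ∀ n → 2 * suc n ≡ suc (suc (2 * n))
    double-suc = solve-∀
    double : ∀ n → 2 * n ≡ n + n
    double = solve-∀
    symmetry : suc (2 * n) C n ≡ suc (2 * n) C suc n
    symmetry = trans (nCk≡nC[n∸k] (m≤n⇒m≤1+n (m≤n*m n 2)))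
      (cong (suc (2 * n) C_) (trans (+-∸-assoc 1 (m≤n*m n 2)) (cong suc (trans (cong (_∸ n) (double n)) (m+n∸n≡m n n)))))
    swap : ∀ a b c → a * (b * c) ≡ b * (a * c)
    swap = solve-∀
    regroup : ∀ n x → suc (suc (2 * n)) * (suc (2 * n) * x) ≡ suc n * (2 * (2 * n + 1) * x)
    regroup = solve-∀


module CentralBinomialSeries where

  open import Defs
  open PowerSeries
  open PowerSeriesRing
  open Derivative
  open SquareRoot
  open CentralBinomial
  open import Data.Nat as N using (ℕ; zero; suc)
  open import Data.Nat.Combinatorics using (_C_)
  open import Data.Integer as Z using (+_; 1ℤ)
  import Data.Integer.Properties as ZP
  open import Relation.Binary.PropositionalEquality as P using (_≡_; refl; cong; cong₂)
  open import Data.Integer.Tactic.RingSolver using (solve-∀)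
  import Data.Nat.Tactic.RingSolver as NS

  centralBinom : ℕ → ℕ
  centralBinom n = (2 N.* n) C n

  W : Series
  W n = + ((2 N.* n N.+ 1) N.* centralBinom n)

  W-recurrence : ∀ n → + suc n Z.* W (suc n) ≡ (+ 4 Z.* + n Z.+ + 6) Z.* W n
  W-recurrence n = P.trans (P.sym (ZP.pos-* (suc n) _)) (P.trans (cong +_ nat) (P.trans (ZP.pos-* (4 N.* n N.+ 6) _)
     (cong (Z._* W n) (P.trans (ZP.pos-+ (4 N.* n) 6) (cong (Z._+ + 6) (ZP.pos-* 4 n))))))
    where
    open P.≡-Reasoning
    nat : suc n N.* ((2 N.* suc n N.+ 1) N.* centralBinom (suc n)) ≡ (4 N.* n N.+ 6) N.* ((2 N.* n N.+ 1) N.* centralBinom n)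
    nat = begin
      suc n N.* ((2 N.* suc n N.+ 1) N.* centralBinom (suc n)) ≡⟨ l1 n (centralBinom (suc n)) ⟩
      (2 N.* suc n N.+ 1) N.* (suc n N.* centralBinom (suc n)) ≡⟨ cong ((2 N.* suc n N.+ 1) N.*_) (centralBinomial-recurrence n) ⟩
      (2 N.* suc n N.+ 1) N.* (2 N.* (2 N.* n N.+ 1) N.* centralBinom n) ≡⟨ l2 n (centralBinom n) ⟩
      (4 N.* n N.+ 6) N.* ((2 N.* n N.+ 1) N.* centralBinom n) ∎
      where
      l1 : ∀ n x → suc n N.* ((2 N.* suc n N.+ 1) N.* x) ≡ (2 N.* suc n N.+ 1) N.* (suc n N.* x)
      l1 = NS.solve-∀
      l2 : ∀ n x → (2 N.* suc n N.+ 1) N.* (2 N.* (2 N.* n N.+ 1) N.* x) ≡ (4 N.* n N.+ 6) N.* ((2 N.* n N.+ 1) N.* x)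
      l2 = NS.solve-∀

  Q⋆-suc : ∀ h k → (Q ⋆ h) (suc k) ≡ h (suc k) Z.+ Z.- (+ 4) Z.* h k
  Q⋆-suc h k = P.trans (⋆-suc Q h k) (cong₂ Z._+_ (ZP.*-identityˡ (h (suc k))) (κ⋆ (Z.- (+ 4)) h k))

  Q⋆∂W : Q ⋆ ∂ W ≈ κ (+ 6) ⋆ W
  Q⋆∂W = mk go
    where
    go : ∀ k → (Q ⋆ ∂ W) k ≡ (κ (+ 6) ⋆ W) k
    go zero = refl
    go (suc k) = P.trans (Q⋆-suc (∂ W) k) (P.trans (cong (Z._+ (Z.- (+ 4) Z.* (+ suc k Z.* W (suc k)))) (W-recurrence (suc k)))
       (P.trans (l (+ k) (W (suc k))) (P.sym (κ⋆ (+ 6) W (suc k)))))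
      where
      l : ∀ k w → (+ 4 Z.* (1ℤ Z.+ k) Z.+ + 6) Z.* w Z.+ Z.- (+ 4) Z.* ((1ℤ Z.+ k) Z.* w) ≡ + 6 Z.* w
      l = solve-∀


module FiniteSums where

  open import Defs
  open import Data.Bool using (Bool; true; false)
  open import Data.Nat
  open import Data.Nat.Properties
  open import Data.List using (List; []; _∷_; map; concatMap; filter; length; _++_)
  open import Data.Product using (_×_; _,_)
  open import Relation.Nullary using (Dec; yes; no; ¬_; _×-dec_)
  open import Relation.Binary.PropositionalEquality
  open import Data.Nat.Tactic.RingSolver using (solve-∀)
  open import Data.Empty using (⊥-elim)

  indicator : ∀ {p} {P : Set p} → Dec P → ℕ
  indicator (yes _) = 1
  indicator (no _) = 0

  indicator-× : ∀ {p q} {P : Set p} {Q : Set q} (a : Dec P) (b : Dec Q) → indicator (a ×-dec b) ≡ indicator a * indicator b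
  indicator-× (yes p) (yes q) = refl
  indicator-× (yes p) (no q) = refl
  indicator-× (no p) b = refl

  indicator-yes : ∀ {p} {P : Set p} (a : Dec P) → P → indicator a ≡ 1
  indicator-yes (yes _) _ = refl
  indicator-yes (no ¬p) p = ⊥-elim (¬p p)
  indicator-no : ∀ {p} {P : Set p} (a : Dec P) → ¬ P → indicator a ≡ 0
  indicator-no (yes p) ¬p = ⊥-elim (¬p p)
  indicator-no (no _) _ = refl

  sumBy : ∀ {a} {A : Set a} → (A → ℕ) → List A → ℕ
  sumBy f [] = 0
  sumBy f (x ∷ xs) = f x + sumBy f xs

  sumBy-cong : ∀ {a} {A : Set a} {f g : A → ℕ} xs → (∀ x → f x ≡ g x) → sumBy f xs ≡ sumBy g xs
  sumBy-cong [] p = refl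
  sumBy-cong (x ∷ xs) p = cong₂ _+_ (p x) (sumBy-cong xs p)

  sumBy-++ : ∀ {a} {A : Set a} (f : A → ℕ) xs ys → sumBy f (xs ++ ys) ≡ sumBy f xs + sumBy f ys
  sumBy-++ f [] ys = refl
  sumBy-++ f (x ∷ xs) ys = trans (cong (f x +_) (sumBy-++ f xs ys)) (sym (+-assoc (f x) _ _))

  sumBy-concatMap : ∀ {a b} {A : Set a} {B : Set b} (f : B → ℕ) (g : A → List B) xs →
    sumBy f (concatMap g xs) ≡ sumBy (λ x → sumBy f (g x)) xs
  sumBy-concatMap f g [] = refl
  sumBy-concatMap f g (x ∷ xs) = trans (sumBy-++ f (g x) (concatMap g xs)) (cong (sumBy f (g x) +_) (sumBy-concatMap f g xs))

  sumBy-map : ∀ {a b} {A : Set a} {B : Set b} (f : B → ℕ) (g : A → B) xs → sumBy f (map g xs) ≡ sumBy (λ x → f (g x)) xs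
  sumBy-map f g [] = refl
  sumBy-map f g (x ∷ xs) = cong (f (g x) +_) (sumBy-map f g xs)

  sumBy-filter : ∀ {a p} {A : Set a} {P : A → Set p} (P? : ∀ x → Dec (P x)) (f : A → ℕ) xs →
    sumBy f (filter P? xs) ≡ sumBy (λ x → indicator (P? x) * f x) xs
  sumBy-filter P? f [] = refl
  sumBy-filter P? f (x ∷ xs) with P? x
  ... | yes _ = cong₂ _+_ (sym (+-identityʳ (f x))) (sumBy-filter P? f xs)
  ... | no _ = sumBy-filter P? f xs

  length-filter : ∀ {a p} {A : Set a} {P : A → Set p} (P? : ∀ x → Dec (P x)) xs →
    length (filter P? xs) ≡ sumBy (λ x → indicator (P? x)) xs
  length-filter P? [] = refl
  length-filter P? (x ∷ xs) with P? x
  ... | yes _ = cong suc (length-filter P? xs)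
  ... | no _ = length-filter P? xs

  length-sumBy : ∀ {a} {A : Set a} (xs : List A) → length xs ≡ sumBy (λ _ → 1) xs
  length-sumBy [] = refl
  length-sumBy (x ∷ xs) = cong suc (length-sumBy xs)

  sumBy-+ : ∀ {a} {A : Set a} (f g : A → ℕ) xs → sumBy (λ x → f x + g x) xs ≡ sumBy f xs + sumBy g xs
  sumBy-+ f g [] = refl
  sumBy-+ f g (x ∷ xs) = trans (cong (f x + g x +_) (sumBy-+ f g xs)) (lem (f x) (g x) (sumBy f xs) (sumBy g xs))
    where
    lem : ∀ a b c d → a + b + (c + d) ≡ a + c + (b + d)
    lem = solve-∀

  sumBy-* : ∀ {a} {A : Set a} (c : ℕ) (f : A → ℕ) xs → sumBy (λ x → c * f x) xs ≡ c * sumBy f xs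
  sumBy-* c f [] = sym (*-zeroʳ c)
  sumBy-* c f (x ∷ xs) = trans (cong (c * f x +_) (sumBy-* c f xs)) (sym (*-distribˡ-+ c (f x) (sumBy f xs)))

  sumBy-0 : ∀ {a} {A : Set a} (xs : List A) → sumBy (λ _ → 0) xs ≡ 0
  sumBy-0 [] = refl
  sumBy-0 (x ∷ xs) = sumBy-0 xs

  -- Sums over 𝒟ₙ are rewritten as sums over all 2²ⁿ words weighted by the Dyck indicator, where
  -- splitting a word into a prefix and a suffix is just a reindexing.
  sumWords : ℕ → (Word → ℕ) → ℕ
  sumWords zero F = F []
  sumWords (suc m) F = sumWords m (λ w → F (true ∷ w)) + sumWords m (λ w → F (false ∷ w))

  sumWords-cong : ∀ m {F G : Word → ℕ} → (∀ w → length w ≡ m → F w ≡ G w) → sumWords m F ≡ sumWords m G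
  sumWords-cong zero p = p [] refl
  sumWords-cong (suc m) p = cong₂ _+_ (sumWords-cong m (λ w q → p (true ∷ w) (cong suc q))) (sumWords-cong m (λ w q → p (false ∷ w) (cong suc q)))

  sumWords-+ : ∀ m (F G : Word → ℕ) → sumWords m (λ w → F w + G w) ≡ sumWords m F + sumWords m G
  sumWords-+ zero F G = refl
  sumWords-+ (suc m) F G = trans (cong₂ _+_ (sumWords-+ m (λ w → F (true ∷ w)) (λ w → G (true ∷ w))) (sumWords-+ m (λ w → F (false ∷ w)) (λ w → G (false ∷ w)))) (lem (sumWords m (λ w → F (true ∷ w))) (sumWords m (λ w → G (true ∷ w))) (sumWords m (λ w → F (false ∷ w))) (sumWords m (λ w → G (false ∷ w))))
    where
    lem : ∀ a b c d → a + b + (c + d) ≡ a + c + (b + d)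
    lem = solve-∀

  sumWords-* : ∀ m c (F : Word → ℕ) → sumWords m (λ w → c * F w) ≡ c * sumWords m F
  sumWords-* zero c F = refl
  sumWords-* (suc m) c F = trans (cong₂ _+_ (sumWords-* m c (λ w → F (true ∷ w))) (sumWords-* m c (λ w → F (false ∷ w)))) (sym (*-distribˡ-+ c _ _))

  sumWords-0 : ∀ m → sumWords m (λ _ → 0) ≡ 0
  sumWords-0 zero = refl
  sumWords-0 (suc m) = cong₂ _+_ (sumWords-0 m) (sumWords-0 m)

  sumWords-++ : ∀ m1 m2 (F : Word → ℕ) → sumWords (m1 + m2) F ≡ sumWords m1 (λ a → sumWords m2 (λ b → F (a ++ b)))
  sumWords-++ zero m2 F = refl
  sumWords-++ (suc m1) m2 F = cong₂ _+_ (sumWords-++ m1 m2 _) (sumWords-++ m1 m2 _)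

  sumWords-words : ∀ m (F : Word → ℕ) → sumBy F (words m) ≡ sumWords m F
  sumWords-words zero F = +-identityʳ _
  sumWords-words (suc m) F = begin
    sumBy F (words (suc m)) ≡⟨ sumBy-concatMap F _ (words m) ⟩
    sumBy (λ w → F (true ∷ w) + (F (false ∷ w) + 0)) (words m) ≡⟨ sumBy-cong (words m) (λ w → cong (F (true ∷ w) +_) (+-identityʳ _)) ⟩
    sumBy (λ w → F (true ∷ w) + F (false ∷ w)) (words m) ≡⟨ sumBy-+ _ _ (words m) ⟩
    sumBy (λ w → F (true ∷ w)) (words m) + sumBy (λ w → F (false ∷ w)) (words m) ≡⟨ cong₂ _+_ (sumWords-words m _) (sumWords-words m _) ⟩
    sumWords (suc m) F ∎
    where open ≡-Reasoning

  eqB : Bool → Bool → ℕ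
  eqB true true = 1
  eqB false false = 1
  eqB _ _ = 0

  eqW : Word → Word → ℕ
  eqW [] [] = 1
  eqW [] (_ ∷ _) = 0
  eqW (_ ∷ _) [] = 0
  eqW (x ∷ a) (y ∷ b) = eqB x y * eqW a b

  eqW-refl : ∀ a → eqW a a ≡ 1
  eqW-refl [] = refl
  eqW-refl (true ∷ a) = trans (+-identityʳ _) (eqW-refl a)
  eqW-refl (false ∷ a) = trans (+-identityʳ _) (eqW-refl a)

  sumWords-δ : ∀ m t (F : Word → ℕ) → length t ≡ m → sumWords m (λ w → eqW w t * F w) ≡ F t
  sumWords-δ zero [] F refl = +-identityʳ _
  sumWords-δ (suc m) (true ∷ t) F refl = trans (cong₂ _+_
      (sumWords-cong m (λ w _ → cong (_* F (true ∷ w)) (+-identityʳ (eqW w t))))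
      (sumWords-cong m {G = λ _ → 0} (λ w _ → refl)))
    (trans (cong₂ _+_ (sumWords-δ m t (λ w → F (true ∷ w)) refl) (sumWords-0 m)) (+-identityʳ _))
  sumWords-δ (suc m) (false ∷ t) F refl = trans (cong₂ _+_
      (sumWords-cong m {G = λ _ → 0} (λ w _ → refl))
      (sumWords-cong m (λ w _ → cong (_* F (false ∷ w)) (+-identityʳ (eqW w t)))))
    (trans (cong (_+ sumWords m (λ w → eqW w t * F (false ∷ w))) (sumWords-0 m)) (sumWords-δ m t (λ w → F (false ∷ w)) refl))

  dyckInd : ℕ → Word → ℕ
  dyckInd k w = indicator (isDyck? k w)

  sumBy-dyck : ∀ k (f : Word → ℕ) → sumBy f (dyck k) ≡ sumWords (2 * k) (λ w → dyckInd k w * f w)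
  sumBy-dyck k f = trans (sumBy-filter (isDyck? k) f (words (2 * k))) (sumWords-words (2 * k) _)


module BalancedWords where

  open import Defs
  open FiniteSums
  open import Data.Bool using (true; false)
  open import Data.Nat
  open import Data.Nat.Properties
  open import Data.Integer as Z using (+_; 0ℤ; 1ℤ; +≤+)
  open import Data.List using ([]; _∷_; length; _++_)
  import Data.List.Properties as LP
  open import Data.List.Relation.Unary.All using (All; []; _∷_)
  open import Data.Product using (_×_; _,_; ∃-syntax)
  open import Relation.Binary.PropositionalEquality

  data Balanced : ℕ → Word → Set where
    done : Balanced 0 []
    up : ∀ {h w} → Balanced (suc h) w → Balanced h (true ∷ w)
    down : ∀ {h w} → Balanced h w → Balanced (suc h) (false ∷ w)

  pos-+1 : ∀ h → + h Z.+ 1ℤ ≡ + suc h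
  pos-+1 h = cong +_ (+-comm h 1)

  heights-u∷ : ∀ h w → heights (+ h) (true ∷ w) ≡ + suc h ∷ heights (+ suc h) w
  heights-u∷ h w rewrite pos-+1 h = refl

  toBalanced : ∀ h w → All (λ x → 0ℤ Z.≤ x) (heights (+ h) w) → h + countU w ≡ countD w → Balanced h w
  toBalanced h [] _ e rewrite +-identityʳ h = subst (λ z → Balanced z []) (sym e) done
  toBalanced h (true ∷ w) ps e with heights-u∷ h w
  toBalanced h (true ∷ w) ps e | q rewrite q with ps
  ... | _ ∷ ps' = up (toBalanced (suc h) w ps' (trans (sym (+-suc h (countU w))) e))
  toBalanced zero (false ∷ w) (() ∷ ps) e
  toBalanced (suc h) (false ∷ w) (_ ∷ ps) e = down (toBalanced h w ps (suc-injective e))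

  fromBalanced : ∀ {h w} → Balanced h w → All (λ x → 0ℤ Z.≤ x) (heights (+ h) w) × h + countU w ≡ countD w
  fromBalanced done = [] , refl
  fromBalanced {h} {true ∷ w} (up p) with fromBalanced p
  ... | ps , e rewrite heights-u∷ h w = (+≤+ z≤n ∷ ps) , trans (+-suc h (countU w)) e
  fromBalanced {suc h} {false ∷ w} (down p) with fromBalanced p
  ... | ps , e = (+≤+ z≤n ∷ ps) , cong suc e

  length≡countU+countD : ∀ w → length w ≡ countU w + countD w
  length≡countU+countD [] = refl
  length≡countU+countD (true ∷ w) = cong suc (length≡countU+countD w)
  length≡countU+countD (false ∷ w) = trans (cong suc (length≡countU+countD w)) (sym (+-suc (countU w) (countD w)))

  Dyck⇒Balanced : ∀ {k w} → IsDyck k w → Balanced 0 w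
  Dyck⇒Balanced {k} {w} ((eu , ed) , ps) = toBalanced 0 w ps (trans eu (sym ed))

  Dyck⇒len : ∀ {k w} → IsDyck k w → length w ≡ 2 * k
  Dyck⇒len {k} {w} ((eu , ed) , ps) = trans (length≡countU+countD w) (trans (cong₂ _+_ eu ed) (cong (_+_ k) (sym (+-identityʳ k))))

  Balanced⇒Dyck : ∀ {w} → Balanced 0 w → IsDyck (countU w) w
  Balanced⇒Dyck g with fromBalanced g
  ... | ps , e = (refl , sym e) , ps

  Balanced-length : ∀ {w} → Balanced 0 w → length w ≡ 2 * countU w
  Balanced-length g = Dyck⇒len (Balanced⇒Dyck g)

  ++-Balanced : ∀ {h k A Y} → Balanced h A → Balanced k Y → Balanced (h + k) (A ++ Y)
  ++-Balanced done q = q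
  ++-Balanced (up p) q = up (++-Balanced p q)
  ++-Balanced (down p) q = down (++-Balanced p q)

  length-suffix< : ∀ (A B : Word) → length B < length (A ++ false ∷ B)
  length-suffix< A B = subst (length B <_) (sym (LP.length-++ A {false ∷ B})) (subst (length B <_) (sym (+-suc (length A) (length B))) (s≤s (m≤n+m (length B) (length A))))

  firstReturn-acc : ∀ n {h w} → length w < n → Balanced (suc h) w → ∃[ A ] ∃[ B ] (w ≡ A ++ false ∷ B × Balanced 0 A × Balanced h B)
  firstReturn-acc (suc n) lt (down p) = [] , _ , refl , done , p
  firstReturn-acc (suc n) {w = true ∷ w'} (s≤s lt) (up p) with firstReturn-acc n lt p
  ... | A1 , B1 , refl , gA1 , gB1 with firstReturn-acc n (<-trans (length-suffix< A1 B1) lt) gB1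
  ... | A2 , B2 , refl , gA2 , gB2 =
    true ∷ A1 ++ false ∷ A2 , B2 , cong (true ∷_) (sym (LP.++-assoc A1 (false ∷ A2) (false ∷ B2))) ,
    up (++-Balanced gA1 (down gA2)) , gB2

  firstReturn : ∀ {h w} → Balanced (suc h) w → ∃[ A ] ∃[ B ] (w ≡ A ++ false ∷ B × Balanced 0 A × Balanced h B)
  firstReturn {w = w} = firstReturn-acc (suc (length w)) ≤-refl

  firstReturn-unique : ∀ {k A A' B B'} → Balanced k A → Balanced k A' → A ++ false ∷ B ≡ A' ++ false ∷ B' → A ≡ A'
  firstReturn-unique done done e = refl
  firstReturn-unique done (up q) ()
  firstReturn-unique (up p) done ()
  firstReturn-unique (up p) (up q) e = cong (true ∷_) (firstReturn-unique p q (LP.∷-injectiveʳ e))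
  firstReturn-unique (down p) (down q) e = cong (false ∷_) (firstReturn-unique p q (LP.∷-injectiveʳ e))

  lastD : Word → ℕ
  lastD [] = 0
  lastD (true ∷ []) = 0
  lastD (false ∷ []) = 1
  lastD (_ ∷ y ∷ w) = lastD (y ∷ w)

  Balanced-lastD : ∀ {h x w} → Balanced h (x ∷ w) → lastD (x ∷ w) ≡ 1
  Balanced-lastD {w = []} (up ())
  Balanced-lastD {w = []} (down done) = refl
  Balanced-lastD {w = y ∷ w} (up p) = Balanced-lastD p
  Balanced-lastD {w = y ∷ w} (down p) = Balanced-lastD p


module ValleyFlips where

  open import Defs
  open FiniteSums
  open import Data.Bool using (Bool; true; false)
  open import Data.Nat
  open import Data.Nat.Properties
  open import Data.List using (List; []; _∷_; length; map)
  import Data.List.Properties as LP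
  open import Relation.Nullary using (yes; no; ¬_)
  open import Relation.Binary.PropositionalEquality
  open import Data.Empty using (⊥-elim)
  import Data.Nat.Tactic.RingSolver as NS

  -- Turning one valley du into a peak ud; these turn out to be exactly the covers of 𝒟ₙ.
  data Flip : Word → Word → Set where
    here : ∀ {w} → Flip (false ∷ true ∷ w) (true ∷ false ∷ w)
    there : ∀ {x a b} → Flip a b → Flip (x ∷ a) (x ∷ b)

  flips : Word → List Word
  flips [] = []
  flips (true ∷ w) = map (true ∷_) (flips w)
  flips (false ∷ []) = []
  flips (false ∷ true ∷ w) = (true ∷ false ∷ w) ∷ map (false ∷_) (flips (true ∷ w))
  flips (false ∷ false ∷ w) = map (false ∷_) (flips (false ∷ w))

  valleys : Word → ℕ
  valleys [] = 0
  valleys (true ∷ w) = valleys w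
  valleys (false ∷ []) = 0
  valleys (false ∷ true ∷ w) = suc (valleys (true ∷ w))
  valleys (false ∷ false ∷ w) = valleys (false ∷ w)

  length-flips : ∀ w → length (flips w) ≡ valleys w
  length-flips [] = refl
  length-flips (true ∷ w) = trans (LP.length-map _ (flips w)) (length-flips w)
  length-flips (false ∷ []) = refl
  length-flips (false ∷ true ∷ w) = cong suc (trans (LP.length-map _ (flips (true ∷ w))) (length-flips (true ∷ w)))
  length-flips (false ∷ false ∷ w) = trans (LP.length-map _ (flips (false ∷ w))) (length-flips (false ∷ w))

  Flip-length : ∀ {a b} → Flip a b → length a ≡ length b
  Flip-length here = refl
  Flip-length (there p) = cong suc (Flip-length p)

  occ : Word → List Word → ℕ
  occ c L = sumBy (eqW c) L

  eqB-neq : ∀ {x y} → x ≢ y → eqB x y ≡ 0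
  eqB-neq {true} {true} p = ⊥-elim (p refl)
  eqB-neq {true} {false} p = refl
  eqB-neq {false} {true} p = refl
  eqB-neq {false} {false} p = ⊥-elim (p refl)

  eqW-neq : ∀ {a b} → a ≢ b → eqW a b ≡ 0
  eqW-neq {[]} {[]} p = ⊥-elim (p refl)
  eqW-neq {[]} {_ ∷ _} p = refl
  eqW-neq {_ ∷ _} {[]} p = refl
  eqW-neq {x ∷ a} {y ∷ b} p with x Data.Bool.≟ y
  ... | no q = cong (_* eqW a b) (eqB-neq q)
  ... | yes refl = trans (cong (eqB x x *_) (eqW-neq (λ e → p (cong (x ∷_) e)))) (*-zeroʳ (eqB x x))

  eqB-refl : ∀ x → eqB x x ≡ 1
  eqB-refl true = refl
  eqB-refl false = refl

  occ-map : ∀ y c x L → occ (y ∷ c) (map (x ∷_) L) ≡ eqB y x * occ c L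
  occ-map y c x L = trans (sumBy-map (eqW (y ∷ c)) (x ∷_) L) (sumBy-* (eqB y x) (eqW c) L)

  occ-map[] : ∀ x L → occ [] (map (x ∷_) L) ≡ 0
  occ-map[] x L = trans (sumBy-map (eqW []) (x ∷_) L) (sumBy-0 L)


  occ-Flip : ∀ {a c} → Flip a c → occ c (flips a) ≡ 1
  occ-Flip {false ∷ true ∷ w} here = cong (_+ occ (true ∷ false ∷ w) (map (false ∷_) (flips (true ∷ w))))
    (eqW-refl (true ∷ false ∷ w)) ∙ cong suc (occ-map true (false ∷ w) false (flips (true ∷ w)))
    where _∙_ = trans
  occ-Flip {true ∷ a} {true ∷ b} (there p) = trans (occ-map true b true (flips a)) (trans (*-identityˡ _) (occ-Flip p))
  occ-Flip {false ∷ true ∷ a} {false ∷ b} (there p) = trans (cong (eqW (false ∷ b) (true ∷ false ∷ a) +_) (occ-map false b false (flips (true ∷ a))))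
    (trans (cong (_+_ 0) (trans (*-identityˡ _) (occ-Flip p))) refl)
  occ-Flip {false ∷ false ∷ a} {false ∷ b} (there p) = trans (occ-map false b false (flips (false ∷ a))) (trans (*-identityˡ _) (occ-Flip p))

  occ-¬Flip : ∀ a c → ¬ Flip a c → occ c (flips a) ≡ 0
  occ-¬Flip [] c np = refl
  occ-¬Flip (true ∷ a) [] np = occ-map[] true (flips a)
  occ-¬Flip (true ∷ a) (true ∷ c) np = trans (occ-map true c true (flips a)) (trans (*-identityˡ _) (occ-¬Flip a c (λ p → np (there p))))
  occ-¬Flip (true ∷ a) (false ∷ c) np = occ-map false c true (flips a)
  occ-¬Flip (false ∷ []) c np = refl
  occ-¬Flip (false ∷ true ∷ a) [] np = occ-map[] false (flips (true ∷ a))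
  occ-¬Flip (false ∷ true ∷ a) (true ∷ c) np = trans (cong₂ _+_ (trans (+-identityʳ _) (eqW-neq (λ e → np (subst (λ z → Flip (false ∷ true ∷ a) (true ∷ z)) (sym e) here))))
    (occ-map true c false (flips (true ∷ a)))) refl
  occ-¬Flip (false ∷ true ∷ a) (false ∷ c) np = trans (cong (_+_ 0) (occ-map false c false (flips (true ∷ a))))
    (trans (*-identityˡ _) (occ-¬Flip (true ∷ a) c (λ p → np (there p))))
  occ-¬Flip (false ∷ false ∷ a) [] np = occ-map[] false (flips (false ∷ a))
  occ-¬Flip (false ∷ false ∷ a) (true ∷ c) np = occ-map true c false (flips (false ∷ a))
  occ-¬Flip (false ∷ false ∷ a) (false ∷ c) np = trans (occ-map false c false (flips (false ∷ a))) (trans (*-identityˡ _) (occ-¬Flip (false ∷ a) c (λ p → np (there p))))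

  startsU : Word → ℕ
  startsU [] = 0
  startsU (true ∷ _) = 1
  startsU (false ∷ _) = 0

  ddu : Word → ℕ
  ddu [] = 0
  ddu (true ∷ w) = ddu w
  ddu (false ∷ []) = 0
  ddu (false ∷ true ∷ w) = ddu (true ∷ w)
  ddu (false ∷ false ∷ []) = 0
  ddu (false ∷ false ∷ true ∷ w) = suc (ddu (false ∷ true ∷ w))
  ddu (false ∷ false ∷ false ∷ w) = ddu (false ∷ false ∷ w)

  duu : Word → ℕ
  duu [] = 0
  duu (true ∷ w) = duu w
  duu (false ∷ []) = 0
  duu (false ∷ false ∷ w) = duu (false ∷ w)
  duu (false ∷ true ∷ []) = 0
  duu (false ∷ true ∷ true ∷ w) = suc (duu (true ∷ true ∷ w))
  duu (false ∷ true ∷ false ∷ w) = duu (true ∷ false ∷ w)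

  valleys-d∷ : ∀ b → valleys (false ∷ b) ≡ startsU b + valleys b
  valleys-d∷ [] = refl
  valleys-d∷ (true ∷ b) = refl
  valleys-d∷ (false ∷ b) = refl

  ddu-dd∷ : ∀ w → ddu (false ∷ false ∷ w) ≡ startsU w + ddu (false ∷ w)
  ddu-dd∷ [] = refl
  ddu-dd∷ (true ∷ w) = refl
  ddu-dd∷ (false ∷ w) = refl

  duu-du∷ : ∀ w → duu (false ∷ true ∷ w) ≡ startsU w + duu w
  duu-du∷ [] = refl
  duu-du∷ (true ∷ w) = refl
  duu-du∷ (false ∷ w) = refl

  startsU-flips-d∷ : ∀ w → sumBy startsU (flips (false ∷ w)) ≡ startsU w
  startsU-flips-d∷ [] = refl
  startsU-flips-d∷ (true ∷ w) = cong suc (trans (sumBy-map startsU (false ∷_) (flips (true ∷ w))) (sumBy-0 (flips (true ∷ w))))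
  startsU-flips-d∷ (false ∷ w) = trans (sumBy-map startsU (false ∷_) (flips (false ∷ w))) (sumBy-0 (flips (false ∷ w)))

  startsU-flips-u∷ : ∀ w → sumBy startsU (flips (true ∷ w)) ≡ valleys w
  startsU-flips-u∷ w = trans (sumBy-map startsU (true ∷_) (flips w)) (trans (sym (length-sumBy (flips w))) (length-flips w))

  sumBy-valleys-d∷ : ∀ L → sumBy (λ b → valleys (false ∷ b)) L ≡ sumBy startsU L + sumBy valleys L
  sumBy-valleys-d∷ L = trans (sumBy-cong L valleys-d∷) (sumBy-+ startsU valleys L)

  flips-valleys : ∀ a → sumBy valleys (flips a) + valleys a ≡ valleys a * valleys a + ddu a + duu a
  flips-valleys [] = refl
  flips-valleys (true ∷ w) = trans (cong (_+ valleys w) (sumBy-map valleys (true ∷_) (flips w))) (flips-valleys w)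
  flips-valleys (false ∷ []) = refl
  flips-valleys (false ∷ true ∷ w) = begin
    (valleys (false ∷ w) + sumBy valleys (map (false ∷_) (flips (true ∷ w)))) + suc (valleys w)
      ≡⟨ cong (λ z → (valleys (false ∷ w) + z) + suc (valleys w)) (trans (sumBy-map valleys (false ∷_) (flips (true ∷ w))) (sumBy-valleys-d∷ (flips (true ∷ w)))) ⟩
    (valleys (false ∷ w) + (sumBy startsU (flips (true ∷ w)) + sumBy valleys (flips (true ∷ w)))) + suc (valleys w)
      ≡⟨ cong₂ (λ a b → (a + (b + sumBy valleys (flips (true ∷ w)))) + suc (valleys w)) (valleys-d∷ w) (startsU-flips-u∷ w) ⟩
    (startsU w + valleys w + (valleys w + sumBy valleys (map (true ∷_) (flips w)))) + suc (valleys w)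
      ≡⟨ cong (λ z → (startsU w + valleys w + (valleys w + z)) + suc (valleys w)) (sumBy-map valleys (true ∷_) (flips w)) ⟩
    (startsU w + valleys w + (valleys w + sumBy valleys (flips w))) + suc (valleys w)
      ≡⟨ lem (startsU w) (valleys w) (sumBy valleys (flips w)) ⟩
    startsU w + suc (valleys w + valleys w) + (sumBy valleys (flips w) + valleys w)
      ≡⟨ cong (λ z → startsU w + suc (valleys w + valleys w) + z) (flips-valleys w) ⟩
    startsU w + suc (valleys w + valleys w) + (valleys w * valleys w + ddu w + duu w)
      ≡⟨ lem2 (startsU w) (valleys w) (ddu w) (duu w) ⟩
    suc (valleys w) * suc (valleys w) + ddu w + (startsU w + duu w)
      ≡⟨ cong (λ z → suc (valleys w) * suc (valleys w) + ddu w + z) (sym (duu-du∷ w)) ⟩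
    suc (valleys w) * suc (valleys w) + ddu w + duu (false ∷ true ∷ w) ∎
    where
    open ≡-Reasoning
    lem : ∀ h v s → (h + v + (v + s)) + suc v ≡ h + suc (v + v) + (s + v)
    lem = NS.solve-∀
    lem2 : ∀ h v d e → h + suc (v + v) + (v * v + d + e) ≡ suc v * suc v + d + (h + e)
    lem2 = NS.solve-∀
  flips-valleys (false ∷ false ∷ w) = begin
    sumBy valleys (map (false ∷_) (flips (false ∷ w))) + valleys (false ∷ w)
      ≡⟨ cong (_+ valleys (false ∷ w)) (trans (sumBy-map valleys (false ∷_) (flips (false ∷ w))) (sumBy-valleys-d∷ (flips (false ∷ w)))) ⟩
    sumBy startsU (flips (false ∷ w)) + sumBy valleys (flips (false ∷ w)) + valleys (false ∷ w)
      ≡⟨ cong (λ z → z + sumBy valleys (flips (false ∷ w)) + valleys (false ∷ w)) (startsU-flips-d∷ w) ⟩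
    startsU w + sumBy valleys (flips (false ∷ w)) + valleys (false ∷ w)
      ≡⟨ +-assoc (startsU w) _ _ ⟩
    startsU w + (sumBy valleys (flips (false ∷ w)) + valleys (false ∷ w))
      ≡⟨ cong (startsU w +_) (flips-valleys (false ∷ w)) ⟩
    startsU w + (valleys (false ∷ w) * valleys (false ∷ w) + ddu (false ∷ w) + duu (false ∷ w))
      ≡⟨ lem (startsU w) (valleys (false ∷ w) * valleys (false ∷ w)) (ddu (false ∷ w)) (duu (false ∷ w)) ⟩
    valleys (false ∷ w) * valleys (false ∷ w) + (startsU w + ddu (false ∷ w)) + duu (false ∷ w)
      ≡⟨ cong (λ z → valleys (false ∷ w) * valleys (false ∷ w) + z + duu (false ∷ w)) (sym (ddu-dd∷ w)) ⟩
    valleys (false ∷ w) * valleys (false ∷ w) + ddu (false ∷ false ∷ w) + duu (false ∷ w) ∎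
    where
    open ≡-Reasoning
    lem : ∀ h a b c → h + (a + b + c) ≡ a + (h + b) + c
    lem = NS.solve-∀


module CoverRelation where

  open import Defs
  open FiniteSums
  open BalancedWords
  open ValleyFlips
  open import Data.Bool using (Bool; true; false)
  open import Data.Nat as N using (ℕ; suc; z≤n; s≤s)
  open import Data.Integer as Z using (ℤ; +_; 0ℤ; 1ℤ; -1ℤ; +≤+; -≤+)
  import Data.Integer.Properties as ZP
  open import Data.List using (List; []; _∷_; length)
  import Data.List.Properties as LP
  open import Data.List.Relation.Binary.Pointwise using (Pointwise; []; _∷_)
  open import Data.List.Relation.Unary.All using (All; []; _∷_)
  open import Data.Product using (_×_; _,_; ∃-syntax)
  open import Data.Sum using (_⊎_; inj₁; inj₂; [_,_]′)
  open import Relation.Nullary using (yes; no; ¬_)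
  open import Relation.Binary.PropositionalEquality
  open import Data.Empty using (⊥-elim)
  open import Data.Integer.Tactic.RingSolver using (solve-∀)
  import Data.Nat.Tactic.RingSolver as NS
  open import Data.List.Properties using (≡-dec)

  PW : List ℤ → List ℤ → Set
  PW = Pointwise Z._≤_

  +-cancelˡ-≡ : ∀ h a b → h Z.+ a ≡ h Z.+ b → a ≡ b
  +-cancelˡ-≡ h a b e = trans (l h a) (trans (cong (Z._+_ (Z.- h)) e) (sym (l h b)))
    where
    l : ∀ h a → a ≡ Z.- h Z.+ (h Z.+ a)
    l = solve-∀

  +-cancelˡ-≤ : ∀ h a b → h Z.+ a Z.≤ h Z.+ b → a Z.≤ b
  +-cancelˡ-≤ h a b p = subst₂ Z._≤_ (sym (l h a)) (sym (l h b)) (ZP.+-monoʳ-≤ (Z.- h) p)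
    where
    l : ∀ h a → a ≡ Z.- h Z.+ (h Z.+ a)
    l = solve-∀

  dec-inc : ∀ h → (h Z.+ -1ℤ) Z.+ 1ℤ ≡ h
  dec-inc = solve-∀
  inc-dec : ∀ h → (h Z.+ 1ℤ) Z.+ -1ℤ ≡ h
  inc-dec = solve-∀

  PW-refl : ∀ xs → PW xs xs
  PW-refl [] = []
  PW-refl (x ∷ xs) = ZP.≤-refl ∷ PW-refl xs

  PW-antisym : ∀ {xs ys} → PW xs ys → PW ys xs → xs ≡ ys
  PW-antisym [] [] = refl
  PW-antisym (p ∷ ps) (q ∷ qs) = cong₂ _∷_ (ZP.≤-antisym p q) (PW-antisym ps qs)

  PW-trans : ∀ {xs ys relS-holds} → PW xs ys → PW ys relS-holds → PW xs relS-holds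
  PW-trans [] [] = []
  PW-trans (p ∷ ps) (q ∷ qs) = ZP.≤-trans p q ∷ PW-trans ps qs

  step-inj : ∀ h x y → h Z.+ step x ≡ h Z.+ step y → x ≡ y
  step-inj h x y e with +-cancelˡ-≡ h (step x) (step y) e
  step-inj h true true e | _ = refl
  step-inj h false false e | _ = refl
  step-inj h true false e | ()
  step-inj h false true e | ()

  heights-inj : ∀ h a b → heights h a ≡ heights h b → a ≡ b
  heights-inj h [] [] e = refl
  heights-inj h (x ∷ a) (y ∷ b) e with step-inj h x y (LP.∷-injectiveˡ e)
  ... | refl = cong (x ∷_) (heights-inj (h Z.+ step x) a b (LP.∷-injectiveʳ e))

  heights-du : ∀ h w → heights h (false ∷ true ∷ w) ≡ (h Z.+ -1ℤ) ∷ h ∷ heights h w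
  heights-du h w = cong ((h Z.+ -1ℤ) ∷_) (cong (λ z → z ∷ heights z w) (dec-inc h))
  heights-ud : ∀ h w → heights h (true ∷ false ∷ w) ≡ (h Z.+ 1ℤ) ∷ h ∷ heights h w
  heights-ud h w = cong ((h Z.+ 1ℤ) ∷_) (cong (λ z → z ∷ heights z w) (inc-dec h))

  Flip-le : ∀ {a c} → Flip a c → ∀ h → PW (heights h a) (heights h c)
  Flip-le (here {w}) h = subst₂ PW (sym (heights-du h w)) (sym (heights-ud h w)) (ZP.+-monoʳ-≤ h -≤+ ∷ (ZP.≤-refl ∷ PW-refl _))
  Flip-le (there {x} p) h = ZP.≤-refl ∷ Flip-le p (h Z.+ step x)

  Flip-neq : ∀ {a c} → Flip a c → a ≢ c
  Flip-neq here ()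
  Flip-neq (there p) e = Flip-neq p (LP.∷-injectiveʳ e)

  Flip-cU : ∀ {a c} → Flip a c → countU a ≡ countU c
  Flip-cU here = refl
  Flip-cU (there {true} p) = cong suc (Flip-cU p)
  Flip-cU (there {false} p) = Flip-cU p

  Flip-cD : ∀ {a c} → Flip a c → countD a ≡ countD c
  Flip-cD here = refl
  Flip-cD (there {true} p) = Flip-cD p
  Flip-cD (there {false} p) = cong suc (Flip-cD p)

  PW-nonneg : ∀ {xs ys} → PW xs ys → All (λ x → 0ℤ Z.≤ x) xs → All (λ x → 0ℤ Z.≤ x) ys
  PW-nonneg [] [] = []
  PW-nonneg (p ∷ ps) (q ∷ qs) = ZP.≤-trans q p ∷ PW-nonneg ps qs

  Flip-Dyck : ∀ {n a c} → IsDyck n a → Flip a c → IsDyck n c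
  Flip-Dyck ((eu , ed) , ps) fl = (trans (sym (Flip-cU fl)) eu , trans (sym (Flip-cD fl)) ed) , PW-nonneg (Flip-le fl 0ℤ) ps

  Flip-between : ∀ {a b} → Flip a b → ∀ h c → PW (heights h a) (heights h c) → PW (heights h c) (heights h b) → c ≡ a ⊎ c ≡ b
  Flip-between (there {x} {a} {b} p) h (y ∷ c) (p1 ∷ ps1) (p2 ∷ ps2) with step-inj h x y (ZP.≤-antisym p1 p2)
  ... | refl with Flip-between p (h Z.+ step x) c ps1 ps2
  ... | inj₁ e = inj₁ (cong (x ∷_) e)
  ... | inj₂ e = inj₂ (cong (x ∷_) e)
  Flip-between (here {w}) h (y ∷ []) (_ ∷ ()) _
  Flip-between (here {w}) h (y1 ∷ y2 ∷ c) P1 P2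
    with subst (λ z → PW z (heights h (y1 ∷ y2 ∷ c))) (heights-du h w) P1 | subst (λ z → PW (heights h (y1 ∷ y2 ∷ c)) z) (heights-ud h w) P2
  ... | _ ∷ (q1 ∷ r1) | _ ∷ (q2 ∷ r2) = resolve y1 y2 E (heights-inj h c w (PW-antisym (tr r2) (tr' r1)))
    where
    E : (h Z.+ step y1) Z.+ step y2 ≡ h
    E = ZP.≤-antisym q2 q1
    tr : PW (heights ((h Z.+ step y1) Z.+ step y2) c) (heights h w) → PW (heights h c) (heights h w)
    tr = subst (λ z → PW (heights z c) (heights h w)) E
    tr' : PW (heights h w) (heights ((h Z.+ step y1) Z.+ step y2) c) → PW (heights h w) (heights h c)
    tr' = subst (λ z → PW (heights h w) (heights z c)) E
    resolve : ∀ y1 y2 → (h Z.+ step y1) Z.+ step y2 ≡ h → c ≡ w → y1 ∷ y2 ∷ c ≡ false ∷ true ∷ w ⊎ y1 ∷ y2 ∷ c ≡ true ∷ false ∷ w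
    resolve false true _ refl = inj₁ refl
    resolve true false _ refl = inj₂ refl
    resolve true true e _ with +-cancelˡ-≡ h (+ 2) 0ℤ (trans (sym (l h)) (trans e (sym (ZP.+-identityʳ h))))
      where
      l : ∀ h → (h Z.+ 1ℤ) Z.+ 1ℤ ≡ h Z.+ + 2
      l = solve-∀
    ... | ()
    resolve false false e _ with +-cancelˡ-≡ h (Z.- + 2) 0ℤ (trans (sym (l h)) (trans e (sym (ZP.+-identityʳ h))))
      where
      l : ∀ h → (h Z.+ -1ℤ) Z.+ -1ℤ ≡ h Z.+ Z.- + 2
      l = solve-∀
    ... | ()

  endHeight : ℤ → Word → ℤ
  endHeight h [] = h
  endHeight h (x ∷ w) = endHeight (h Z.+ step x) w

  endHeight-count : ∀ h w → endHeight h w Z.+ + countD w ≡ h Z.+ + countU w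
  endHeight-count h [] = refl
  endHeight-count h (true ∷ w) = trans (endHeight-count (h Z.+ 1ℤ) w) (l h (+ countU w))
    where
    l : ∀ h u → h Z.+ 1ℤ Z.+ u ≡ h Z.+ (1ℤ Z.+ u)
    l = solve-∀
  endHeight-count h (false ∷ w) = trans (l (endHeight (h Z.+ -1ℤ) w) (+ countD w)) (trans (cong (Z._+ 1ℤ) (endHeight-count (h Z.+ -1ℤ) w)) (l2 h (+ countU w)))
    where
    l : ∀ f d → f Z.+ (1ℤ Z.+ d) ≡ f Z.+ d Z.+ 1ℤ
    l = solve-∀
    l2 : ∀ h u → h Z.+ -1ℤ Z.+ u Z.+ 1ℤ ≡ h Z.+ u
    l2 = solve-∀

  endHeight-Dyck : ∀ {n a b} → IsDyck n a → IsDyck n b → endHeight 0ℤ a ≡ endHeight 0ℤ b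
  endHeight-Dyck {n} {a} {b} ((ua , da) , _) ((ub , db) , _) = +-cancelˡ-≡ (+ n) (endHeight 0ℤ a) (endHeight 0ℤ b)
    (trans (ZP.+-comm (+ n) (endHeight 0ℤ a)) (trans (cong (λ z → endHeight 0ℤ a Z.+ + z) (sym da)) (trans (endHeight-count 0ℤ a)
    (trans (cong (λ z → 0ℤ Z.+ + z) (trans ua (sym ub))) (trans (sym (endHeight-count 0ℤ b)) (trans (cong (λ z → endHeight 0ℤ b Z.+ + z) db) (ZP.+-comm (endHeight 0ℤ b) (+ n))))))))

  oddHeight : ℕ → ℤ
  oddHeight k = + suc (2 N.* k)

  oddHeight-suc : ∀ k → oddHeight (suc k) ≡ oddHeight k Z.+ + 2
  oddHeight-suc k = trans (cong +_ (l k)) (ZP.pos-+ (suc (2 N.* k)) 2)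
    where
    l : ∀ k → suc (2 N.* suc k) ≡ suc (2 N.* k) N.+ 2
    l = NS.solve-∀

  oddHeight≥1 : ∀ H k → H Z.+ 1ℤ Z.≤ H Z.+ oddHeight k
  oddHeight≥1 H k = ZP.+-monoʳ-≤ H (+≤+ (s≤s z≤n))

  -- Once a steps down where b steps up, the gap between b and the descending a stays odd, hence
  -- positive, so the valley at the bottom of a's descent can be flipped without passing b.
  flip-towards-descent : ∀ H k a b → PW (heights (H Z.+ -1ℤ) a) (heights (H Z.+ oddHeight k) b) → endHeight (H Z.+ -1ℤ) a ≡ endHeight (H Z.+ oddHeight k) b →
    ∃[ c ] (Flip (false ∷ a) c × PW (heights H c) ((H Z.+ oddHeight k) ∷ heights (H Z.+ oddHeight k) b))
  flip-towards-descent H k [] [] [] f with +-cancelˡ-≡ H -1ℤ (oddHeight k) f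
  ... | ()
  flip-towards-descent H k (true ∷ a) (y ∷ b) (p ∷ ps) f =
    true ∷ false ∷ a , here ,
    subst (λ z → PW z ((H Z.+ oddHeight k) ∷ heights (H Z.+ oddHeight k) (y ∷ b))) (sym (heights-ud H a))
      (oddHeight≥1 H k ∷ (subst (λ z → z Z.≤ (H Z.+ oddHeight k) Z.+ step y) (dec-inc H) p ∷ subst (λ z → PW (heights z a) (heights ((H Z.+ oddHeight k) Z.+ step y) b)) (dec-inc H) ps))
  flip-towards-descent H k (false ∷ a) (y ∷ b) (p ∷ ps) f with nextGap y
    where
    nextGap : ∀ y → ∃[ k' ] ((H Z.+ oddHeight k) Z.+ step y ≡ (H Z.+ -1ℤ) Z.+ oddHeight k')
    nextGap true = suc k , trans (l H (oddHeight k)) (cong (Z._+_ (H Z.+ -1ℤ)) (sym (oddHeight-suc k)))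
      where
      l : ∀ H K → H Z.+ K Z.+ 1ℤ ≡ H Z.+ -1ℤ Z.+ (K Z.+ + 2)
      l = solve-∀
    nextGap false = k , l H (oddHeight k)
      where
      l : ∀ H K → H Z.+ K Z.+ -1ℤ ≡ H Z.+ -1ℤ Z.+ K
      l = solve-∀
  ... | k' , eK with flip-towards-descent (H Z.+ -1ℤ) k' a b (subst (λ z → PW (heights ((H Z.+ -1ℤ) Z.+ -1ℤ) a) (heights z b)) eK ps)
                       (trans f (cong (λ z → endHeight z b) eK))
  ... | c , fl , pw = false ∷ c , there fl ,
     (ZP.+-monoʳ-≤ H -≤+ ∷ subst (λ z → PW (heights (H Z.+ -1ℤ) c) (z ∷ heights z b)) (sym eK) pw)

  flip-towards : ∀ h a b → PW (heights h a) (heights h b) → a ≢ b → endHeight h a ≡ endHeight h b → ∃[ c ] (Flip a c × PW (heights h c) (heights h b))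
  flip-towards h [] [] [] ne f = ⊥-elim (ne refl)
  flip-towards h (true ∷ a) (true ∷ b) (p ∷ ps) ne f with flip-towards (h Z.+ 1ℤ) a b ps (λ e → ne (cong (true ∷_) e)) f
  ... | c , fl , pw = true ∷ c , there fl , p ∷ pw
  flip-towards h (false ∷ a) (false ∷ b) (p ∷ ps) ne f with flip-towards (h Z.+ -1ℤ) a b ps (λ e → ne (cong (false ∷_) e)) f
  ... | c , fl , pw = false ∷ c , there fl , p ∷ pw
  flip-towards h (true ∷ a) (false ∷ b) (p ∷ ps) ne f with +-cancelˡ-≤ h 1ℤ -1ℤ p
  ... | ()
  flip-towards h (false ∷ a) (true ∷ b) (p ∷ ps) ne f = flip-towards-descent h 0 a b ps f

  open import Data.List.Membership.Propositional using (_∈_)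
  open import Data.List.Membership.Propositional.Properties using (∈-concatMap⁺; ∈-filter⁺)
  import Data.List.Relation.Unary.All as All
  open import Data.List.Relation.Unary.Any as Any using (here; there)

  ∈-words : ∀ w → w ∈ words (length w)
  ∈-words [] = here refl
  ∈-words (true ∷ w) = ∈-concatMap⁺ _ (Any.map (λ { refl → here refl }) (∈-words w))
  ∈-words (false ∷ w) = ∈-concatMap⁺ _ (Any.map (λ { refl → there (here refl) }) (∈-words w))

  ∈-dyck : ∀ {n c} → IsDyck n c → c ∈ dyck n
  ∈-dyck {n} {c} d = ∈-filter⁺ (isDyck? n) (subst (λ m → c ∈ words m) (Dyck⇒len d) (∈-words c)) d

  Flip⇒covers : ∀ n {a b} → Flip a b → Covers n a b
  Flip⇒covers n {a} {b} fl = (Flip-le fl 0ℤ , Flip-neq fl) ,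
    All.tabulate (λ {c} _ → λ { ((le1 , n1) , (le2 , n2)) → [ (λ e → n1 (sym e)) , n2 ]′ (Flip-between fl 0ℤ c le1 le2) })

  covers⇒Flip : ∀ {n a b} → IsDyck n a → IsDyck n b → Covers n a b → Flip a b
  covers⇒Flip {n} {a} {b} da db ((le , ne) , noMid) with flip-towards 0ℤ a b le ne (endHeight-Dyck da db)
  ... | c , fl , pw with ≡-dec Data.Bool._≟_ c b
  ... | yes refl = fl
  ... | no c≢b = ⊥-elim (All.lookup noMid (∈-dyck (Flip-Dyck da fl)) ((Flip-le fl 0ℤ , Flip-neq fl) , (pw , c≢b)))

  covers≡occ-flips : ∀ n a c → IsDyck n a → dyckInd n c N.* indicator (covers? n a c) ≡ occ c (flips a)
  covers≡occ-flips n a c da with isDyck? n c | covers? n a c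
  ... | yes dc | yes cv = sym (occ-Flip (covers⇒Flip da dc cv))
  ... | yes dc | no ncv = sym (occ-¬Flip a c (λ fl → ncv (Flip⇒covers n fl)))
  ... | no ndc | _ = sym (occ-¬Flip a c (λ fl → ndc (Flip-Dyck da fl)))


module ChainCount where

  open import Defs
  open FiniteSums
  open BalancedWords
  open ValleyFlips
  open CoverRelation using (covers≡occ-flips)
  open import Data.Bool using (true; false)
  open import Data.Nat
  open import Data.Nat.Properties
  open import Data.List using (List; []; _∷_; length; map; concatMap)
  open import Data.List.Relation.Unary.All using (All; []; _∷_)
  import Data.List.Relation.Unary.All.Properties as AllP
  open import Data.Product using (_×_; _,_)
  open import Relation.Nullary using (yes; no)
  open import Relation.Binary.PropositionalEquality
  import Data.List.Relation.Unary.All as All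

  dyckInd-elim : ∀ n (G G' : Word → ℕ) b → (IsDyck n b → G b ≡ G' b) → dyckInd n b * G b ≡ dyckInd n b * G' b
  dyckInd-elim n G G' b p with isDyck? n b
  ... | yes d = cong (1 *_) (p d)
  ... | no _ = refl

  sumBy-congD : ∀ n (f g : Word → ℕ) → (∀ a → IsDyck n a → f a ≡ g a) → sumBy f (dyck n) ≡ sumBy g (dyck n)
  sumBy-congD n f g p = trans (sumBy-dyck n f) (trans (sumWords-cong (2 * n) (λ w _ → dyckInd-elim n f g w (p w))) (sym (sumBy-dyck n g)))

  sumWords-sumBy : ∀ m (L : List Word) (G : Word → Word → ℕ) → sumWords m (λ w → sumBy (G w) L) ≡ sumBy (λ t → sumWords m (λ w → G w t)) L
  sumWords-sumBy m [] G = sumWords-0 m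
  sumWords-sumBy m (t ∷ L) G = trans (sumWords-+ m (λ w → G w t) (λ w → sumBy (G w) L)) (cong (sumWords m (λ w → G w t) +_) (sumWords-sumBy m L G))

  sumBy-*ʳ : ∀ {A : Set} (f : A → ℕ) xs c → sumBy f xs * c ≡ sumBy (λ x → f x * c) xs
  sumBy-*ʳ f xs c = trans (*-comm (sumBy f xs) c) (trans (sym (sumBy-* c f xs)) (sumBy-cong xs (λ x → *-comm c (f x))))

  sumBy-congA : ∀ {A : Set} {P : A → Set} {f g : A → ℕ} {xs} → All P xs → (∀ x → P x → f x ≡ g x) → sumBy f xs ≡ sumBy g xs
  sumBy-congA [] q = refl
  sumBy-congA (p ∷ ps) q = cong₂ _+_ (q _ p) (sumBy-congA ps q)

  sumWords-occ : ∀ m L (F : Word → ℕ) → All (λ t → length t ≡ m) L → sumWords m (λ w → occ w L * F w) ≡ sumBy F L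
  sumWords-occ m L F al = trans (sumWords-cong m (λ w _ → sumBy-*ʳ (eqW w) L (F w)))
    (trans (sumWords-sumBy m L (λ w t → eqW w t * F w)) (sumBy-congA al (λ t p → sumWords-δ m t F p)))

  flips-len : ∀ a → All (λ t → length t ≡ length a) (flips a)
  flips-len [] = []
  flips-len (true ∷ w) = AllP.map⁺ (All.map (cong suc) (flips-len w))
  flips-len (false ∷ []) = []
  flips-len (false ∷ true ∷ w) = refl ∷ AllP.map⁺ (All.map (cong suc) (flips-len (true ∷ w)))
  flips-len (false ∷ false ∷ w) = AllP.map⁺ (All.map (cong suc) (flips-len (false ∷ w)))

  flipsD-len : ∀ {n a} → IsDyck n a → All (λ t → length t ≡ 2 * n) (flips a)
  flipsD-len {n} {a} d = Data.List.Relation.Unary.All.map (λ e → trans e (Dyck⇒len d)) (flips-len a)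

  sumBy-covers : ∀ n a (F : Word → ℕ) → IsDyck n a → sumBy (λ c → indicator (covers? n a c) * F c) (dyck n) ≡ sumBy F (flips a)
  sumBy-covers n a F da = trans (sumBy-dyck n _) (trans (sumWords-cong (2 * n) (λ c _ → trans (sym (*-assoc (dyckInd n c) _ (F c))) (cong (_* F c) (covers≡occ-flips n a c da))))
    (sumWords-occ (2 * n) (flips a) F (flipsD-len da)))

  covers-count : ∀ n b → IsDyck n b → sumBy (λ c → indicator (covers? n b c)) (dyck n) ≡ valleys b
  covers-count n b db = trans (sumBy-cong (dyck n) (λ c → sym (*-identityʳ (indicator (covers? n b c)))))
    (trans (sumBy-covers n b (λ _ → 1) db) (trans (sym (length-sumBy (flips b))) (length-flips b)))

  sc2≡Σflips-valleys : ∀ n → sc2 n ≡ sumBy (λ a → sumBy valleys (flips a)) (dyck n)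
  sc2≡Σflips-valleys n = begin
    sc2 n ≡⟨ length-filter (sat2? n) (triples n) ⟩
    sumBy (λ t → indicator (sat2? n t)) (triples n) ≡⟨ sumBy-concatMap _ _ (dyck n) ⟩
    sumBy (λ a → sumBy (λ t → indicator (sat2? n t)) (concatMap (λ b → map (λ c → a , b , c) (dyck n)) (dyck n))) (dyck n)
      ≡⟨ sumBy-cong (dyck n) (λ a → trans (sumBy-concatMap _ _ (dyck n)) (sumBy-cong (dyck n) (λ b → sumBy-map _ _ (dyck n)))) ⟩
    sumBy (λ a → sumBy (λ b → sumBy (λ c → indicator (sat2? n (a , b , c))) (dyck n)) (dyck n)) (dyck n)
      ≡⟨ sumBy-cong (dyck n) (λ a → sumBy-cong (dyck n) (λ b → trans (sumBy-cong (dyck n) (λ c → indicator-× (covers? n a b) (covers? n b c)))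
            (sumBy-* (indicator (covers? n a b)) (λ c → indicator (covers? n b c)) (dyck n)))) ⟩
    sumBy (λ a → sumBy (λ b → indicator (covers? n a b) * sumBy (λ c → indicator (covers? n b c)) (dyck n)) (dyck n)) (dyck n)
      ≡⟨ sumBy-cong (dyck n) (λ a → sumBy-congD n _ _ (λ b db → cong (indicator (covers? n a b) *_) (covers-count n b db))) ⟩
    sumBy (λ a → sumBy (λ b → indicator (covers? n a b) * valleys b) (dyck n)) (dyck n)
      ≡⟨ sumBy-congD n _ _ (λ a da → sumBy-covers n a valleys da) ⟩
    sumBy (λ a → sumBy valleys (flips a)) (dyck n) ∎
    where open ≡-Reasoning

  sc2+Σvalleys : ∀ n → sc2 n + sumBy valleys (dyck n) ≡ sumBy (λ a → valleys a * valleys a + ddu a + duu a) (dyck n)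
  sc2+Σvalleys n = trans (cong (_+ sumBy valleys (dyck n)) (sc2≡Σflips-valleys n)) (trans (sym (sumBy-+ _ valleys (dyck n))) (sumBy-cong (dyck n) flips-valleys))


module FirstReturn where

  open import Defs
  open FiniteSums
  open BalancedWords
  open import Data.Bool using (true; false)
  open import Data.Nat
  open import Data.Nat.Properties
  open import Data.List using ([]; _∷_; length; _++_; take; drop; applyUpTo)
  import Data.List.Properties as LP
  open import Data.List.Relation.Unary.All using ([]; _∷_)
  open import Data.Product using (_×_; _,_; proj₁; ∃-syntax)
  open import Data.Sum using (_⊎_; inj₁; inj₂)
  open import Relation.Nullary using (yes; no)
  open import Relation.Binary.PropositionalEquality
  open import Data.Empty using (⊥; ⊥-elim)
  import Data.Nat.Tactic.RingSolver as NS

  downThenDyck : ℕ → Word → ℕ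
  downThenDyck j [] = 0
  downThenDyck j (true ∷ _) = 0
  downThenDyck j (false ∷ B) = dyckInd j B

  -- Indicator of w = u A d B with A ∈ 𝒟ᵢ and B ∈ 𝒟ₙ₋ᵢ.
  firstReturnAt : ℕ → ℕ → Word → ℕ
  firstReturnAt n i [] = 0
  firstReturnAt n i (false ∷ w) = 0
  firstReturnAt n i (true ∷ w) = dyckInd i (take (2 * i) w) * downThenDyck (n ∸ i) (drop (2 * i) w)

  countU-++ : ∀ A B → countU (A ++ B) ≡ countU A + countU B
  countU-++ [] B = refl
  countU-++ (true ∷ A) B = cong suc (countU-++ A B)
  countU-++ (false ∷ A) B = countU-++ A B

  take-length-++ : ∀ (A r : Word) → take (length A) (A ++ r) ≡ A
  take-length-++ [] r = refl
  take-length-++ (x ∷ A) r = cong (x ∷_) (take-length-++ A r)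

  drop-length-++ : ∀ (A r : Word) → drop (length A) (A ++ r) ≡ r
  drop-length-++ [] r = refl
  drop-length-++ (x ∷ A) r = drop-length-++ A r

  firstReturnAt-view : ∀ n i w → firstReturnAt n i w ≡ 0 ⊎ (firstReturnAt n i w ≡ 1 × ∃[ A ] ∃[ B ] (w ≡ true ∷ A ++ false ∷ B × IsDyck i A × IsDyck (n ∸ i) B))
  firstReturnAt-view n i [] = inj₁ refl
  firstReturnAt-view n i (false ∷ w) = inj₁ refl
  firstReturnAt-view n i (true ∷ w) with isDyck? i (take (2 * i) w) | drop (2 * i) w | LP.take++drop≡id (2 * i) w
  ... | no _ | _ | _ = inj₁ refl
  ... | yes dA | [] | _ = inj₁ refl
  ... | yes dA | true ∷ _ | _ = inj₁ refl
  ... | yes dA | false ∷ B | e with isDyck? (n ∸ i) B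
  ...   | no _ = inj₁ refl
  ...   | yes dB = inj₂ (refl , take (2 * i) w , B , cong (true ∷_) (sym e) , dA , dB)

  u∷A++d∷B-Dyck : ∀ n i A B → i ≤ n → IsDyck i A → IsDyck (n ∸ i) B → IsDyck (suc n) (true ∷ A ++ false ∷ B)
  u∷A++d∷B-Dyck n i A B le dA dB = subst (λ k → IsDyck k (true ∷ A ++ false ∷ B)) cu (Balanced⇒Dyck g)
    where
    g : Balanced 0 (true ∷ A ++ false ∷ B)
    g = up (++-Balanced (Dyck⇒Balanced dA) (down (Dyck⇒Balanced dB)))
    cu : countU (true ∷ A ++ false ∷ B) ≡ suc n
    cu = cong suc (trans (countU-++ A (false ∷ B)) (trans (cong₂ _+_ (proj₁ (proj₁ dA)) (proj₁ (proj₁ dB))) (m+[n∸m]≡n le)))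

  sumℕ : ℕ → (ℕ → ℕ) → ℕ
  sumℕ zero f = 0
  sumℕ (suc m) f = f 0 + sumℕ m (λ i → f (suc i))

  sumBy-applyUpTo : ∀ (F : ℕ → ℕ) g m → sumBy F (applyUpTo g m) ≡ sumℕ m (λ i → F (g i))
  sumBy-applyUpTo F g zero = refl
  sumBy-applyUpTo F g (suc m) = cong (F (g 0) +_) (sumBy-applyUpTo F (λ i → g (suc i)) m)

  sumℕ-cong : ∀ m {f g : ℕ → ℕ} → (∀ i → i < m → f i ≡ g i) → sumℕ m f ≡ sumℕ m g
  sumℕ-cong zero p = refl
  sumℕ-cong (suc m) p = cong₂ _+_ (p 0 (s≤s z≤n)) (sumℕ-cong m (λ i q → p (suc i) (s≤s q)))

  sumℕ-0 : ∀ m → sumℕ m (λ _ → 0) ≡ 0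
  sumℕ-0 zero = refl
  sumℕ-0 (suc m) = sumℕ-0 m

  sumℕ-δ : ∀ m j → j < m → sumℕ m (λ i → indicator (i ≟ j)) ≡ 1
  sumℕ-δ (suc m) zero _ = cong suc (trans (sumℕ-cong m (λ i _ → refl)) (sumℕ-0 m))
  sumℕ-δ (suc m) (suc j) (s≤s lt) = trans (sumℕ-cong m (λ i _ → indicator-suc i j)) (sumℕ-δ m j lt)
    where
    indicator-suc : ∀ i j → indicator (suc i ≟ suc j) ≡ indicator (i ≟ j)
    indicator-suc i j with i ≟ j
    ... | yes refl = indicator-yes (suc i ≟ suc i) refl
    ... | no ne = indicator-no (suc i ≟ suc j) (λ e → ne (suc-injective e))

  dyckInd-suc : ∀ n w → dyckInd (suc n) w ≡ sumℕ (suc n) (λ i → firstReturnAt n i w)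
  dyckInd-suc n w with isDyck? (suc n) w
  ... | no nd = sym (trans (sumℕ-cong (suc n) (λ i lt → z i lt)) (sumℕ-0 (suc n)))
    where
    z : ∀ i → i < suc n → firstReturnAt n i w ≡ 0
    z i lt with firstReturnAt-view n i w
    ... | inj₁ e = e
    ... | inj₂ (_ , A , B , refl , dA , dB) = ⊥-elim (nd (u∷A++d∷B-Dyck n i A B (≤-pred lt) dA dB))
  ... | yes d with Dyck⇒Balanced d
  ... | up g1 with firstReturn g1
  ... | A , B , refl , gA , gB = sym (trans (sumℕ-cong (suc n) (λ i _ → Ri i)) (sumℕ-δ (suc n) i0 i0<))
    where
    i0 = countU A
    cw : countU A + countU B ≡ n
    cw = suc-injective (trans (cong suc (sym (countU-++ A (false ∷ B)))) (proj₁ (proj₁ d)))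
    i0< : i0 < suc n
    i0< = s≤s (subst (countU A ≤_) cw (m≤m+n (countU A) (countU B)))
    lenA : length A ≡ 2 * i0
    lenA = Balanced-length gA
    Rval : firstReturnAt n i0 (true ∷ A ++ false ∷ B) ≡ 1
    Rval = trans (cong₂ (λ a b → dyckInd i0 a * downThenDyck (n ∸ i0) b)
        (trans (cong (λ m → take m (A ++ false ∷ B)) (sym lenA)) (take-length-++ A (false ∷ B)))
        (trans (cong (λ m → drop m (A ++ false ∷ B)) (sym lenA)) (drop-length-++ A (false ∷ B))))
      (cong₂ _*_ (indicator-yes (isDyck? i0 A) (Balanced⇒Dyck gA))
         (indicator-yes (isDyck? (n ∸ i0) B) (subst (λ k → IsDyck k B) (trans (sym (m+n∸m≡n (countU A) (countU B))) (cong (_∸ countU A) cw)) (Balanced⇒Dyck gB))))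
    Ri : ∀ i → firstReturnAt n i (true ∷ A ++ false ∷ B) ≡ indicator (i ≟ i0)
    Ri i with firstReturnAt-view n i (true ∷ A ++ false ∷ B)
    ... | inj₂ (at≡1 , A' , B' , e , dA' , dB') with firstReturn-unique gA (Dyck⇒Balanced dA') (LP.∷-injectiveʳ e)
    ...   | refl = trans at≡1 (sym (indicator-yes (i ≟ i0) (sym (proj₁ (proj₁ dA')))))
    Ri i | inj₁ e with i ≟ i0
    ...   | no _ = e
    ...   | yes refl = ⊥-elim (contra e)
      where
      contra : firstReturnAt n i0 (true ∷ A ++ false ∷ B) ≡ 0 → ⊥
      contra e0 with trans (sym e0) Rval
      ... | ()

  sumWords-sumℕ : ∀ m k (G : Word → ℕ → ℕ) → sumWords m (λ w → sumℕ k (G w)) ≡ sumℕ k (λ i → sumWords m (λ w → G w i))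
  sumWords-sumℕ m zero G = sumWords-0 m
  sumWords-sumℕ m (suc k) G = trans (sumWords-+ m (λ w → G w 0) (λ w → sumℕ k (λ i → G w (suc i))))
    (cong (sumWords m (λ w → G w 0) +_) (sumWords-sumℕ m k (λ w i → G w (suc i))))

  sumℕ-*ʳ : ∀ k (f : ℕ → ℕ) c → sumℕ k f * c ≡ sumℕ k (λ i → f i * c)
  sumℕ-*ʳ zero f c = refl
  sumℕ-*ʳ (suc k) f c = trans (*-distribʳ-+ c (f 0) _) (cong (f 0 * c +_) (sumℕ-*ʳ k (λ i → f (suc i)) c))

  sumWords-firstReturnAt : ∀ n i (f : Word → ℕ) → i ≤ n →
    sumWords (2 * suc n) (λ w → firstReturnAt n i w * f w) ≡ sumBy (λ A → sumBy (λ B → f (true ∷ A ++ false ∷ B)) (dyck (n ∸ i))) (dyck i)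
  sumWords-firstReturnAt n i f le = begin
    sumWords (2 * suc n) F ≡⟨ cong (λ m → sumWords m F) len ⟩
    sumWords (2 * i + suc (2 * j)) (λ w → F (true ∷ w)) + sumWords (2 * i + suc (2 * j)) (λ w → F (false ∷ w))
      ≡⟨ cong (sumWords (2 * i + suc (2 * j)) (λ w → F (true ∷ w)) +_) (sumWords-0 (2 * i + suc (2 * j))) ⟩
    sumWords (2 * i + suc (2 * j)) (λ w → F (true ∷ w)) + 0 ≡⟨ +-identityʳ _ ⟩
    sumWords (2 * i + suc (2 * j)) (λ w → F (true ∷ w)) ≡⟨ sumWords-++ (2 * i) (suc (2 * j)) (λ w → F (true ∷ w)) ⟩
    sumWords (2 * i) (λ A → sumWords (suc (2 * j)) (λ r → F (true ∷ A ++ r)))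
      ≡⟨ sumWords-cong (2 * i) (λ A lA → inner A lA) ⟩
    sumWords (2 * i) (λ A → dyckInd i A * sumWords (2 * j) (λ B → dyckInd j B * f (true ∷ A ++ false ∷ B)))
      ≡⟨ sumWords-cong (2 * i) (λ A _ → cong (dyckInd i A *_) (sym (sumBy-dyck j (λ B → f (true ∷ A ++ false ∷ B))))) ⟩
    sumWords (2 * i) (λ A → dyckInd i A * sumBy (λ B → f (true ∷ A ++ false ∷ B)) (dyck j))
      ≡⟨ sym (sumBy-dyck i _) ⟩
    sumBy (λ A → sumBy (λ B → f (true ∷ A ++ false ∷ B)) (dyck j)) (dyck i) ∎
    where
    open ≡-Reasoning
    j = n ∸ i
    F = λ w → firstReturnAt n i w * f w
    len : 2 * suc n ≡ suc (2 * i + suc (2 * j))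
    len = trans (cong (λ z → 2 * suc z) (sym (m+[n∸m]≡n le))) (l i j)
      where
      l : ∀ i j → 2 * suc (i + j) ≡ suc (2 * i + suc (2 * j))
      l = NS.solve-∀
    inner : ∀ A → length A ≡ 2 * i → sumWords (suc (2 * j)) (λ r → F (true ∷ A ++ r)) ≡ dyckInd i A * sumWords (2 * j) (λ B → dyckInd j B * f (true ∷ A ++ false ∷ B))
    inner A lA = begin
      sumWords (suc (2 * j)) (λ r → F (true ∷ A ++ r))
        ≡⟨ sumWords-cong (suc (2 * j)) (λ r _ → trans (cong₂ (λ a b → dyckInd i a * downThenDyck j b * f (true ∷ A ++ r))
              (trans (cong (λ m → take m (A ++ r)) (sym lA)) (take-length-++ A r)) (trans (cong (λ m → drop m (A ++ r)) (sym lA)) (drop-length-++ A r)))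
              (*-assoc (dyckInd i A) (downThenDyck j r) _)) ⟩
      sumWords (suc (2 * j)) (λ r → dyckInd i A * (downThenDyck j r * f (true ∷ A ++ r)))
        ≡⟨ sumWords-* (suc (2 * j)) (dyckInd i A) (λ r → downThenDyck j r * f (true ∷ A ++ r)) ⟩
      dyckInd i A * (sumWords (2 * j) (λ B → 0) + sumWords (2 * j) (λ B → dyckInd j B * f (true ∷ A ++ false ∷ B)))
        ≡⟨ cong (λ z → dyckInd i A * (z + sumWords (2 * j) (λ B → dyckInd j B * f (true ∷ A ++ false ∷ B)))) (sumWords-0 (2 * j)) ⟩
      dyckInd i A * sumWords (2 * j) (λ B → dyckInd j B * f (true ∷ A ++ false ∷ B)) ∎

  sumBy-dyck-suc : ∀ n (f : Word → ℕ) → sumBy f (dyck (suc n)) ≡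
    sumℕ (suc n) (λ i → sumBy (λ A → sumBy (λ B → f (true ∷ A ++ false ∷ B)) (dyck (n ∸ i))) (dyck i))
  sumBy-dyck-suc n f = begin
    sumBy f (dyck (suc n)) ≡⟨ sumBy-dyck (suc n) f ⟩
    sumWords (2 * suc n) (λ w → dyckInd (suc n) w * f w) ≡⟨ sumWords-cong (2 * suc n) (λ w _ → trans (cong (_* f w) (dyckInd-suc n w)) (sumℕ-*ʳ (suc n) (λ i → firstReturnAt n i w) (f w))) ⟩
    sumWords (2 * suc n) (λ w → sumℕ (suc n) (λ i → firstReturnAt n i w * f w)) ≡⟨ sumWords-sumℕ (2 * suc n) (suc n) (λ w i → firstReturnAt n i w * f w) ⟩
    sumℕ (suc n) (λ i → sumWords (2 * suc n) (λ w → firstReturnAt n i w * f w)) ≡⟨ sumℕ-cong (suc n) (λ i lt → sumWords-firstReturnAt n i f (≤-pred lt)) ⟩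
    sumℕ (suc n) (λ i → sumBy (λ A → sumBy (λ B → f (true ∷ A ++ false ∷ B)) (dyck (n ∸ i))) (dyck i)) ∎
    where open ≡-Reasoning


module PatternCounts where

  open import Defs
  open FiniteSums
  open BalancedWords
  open ValleyFlips
  open import Data.Bool using (true; false)
  open import Data.Nat
  open import Data.Nat.Properties
  open import Data.List using ([]; _∷_; _++_)
  open import Relation.Binary.PropositionalEquality
  import Data.Nat.Tactic.RingSolver as NS

  startsUU : Word → ℕ
  startsUU (true ∷ w) = startsU w
  startsUU _ = 0

  valleys-++-d∷ : ∀ A B → valleys (A ++ false ∷ B) ≡ valleys A + valleys (false ∷ B)
  valleys-++-d∷ [] B = refl
  valleys-++-d∷ (true ∷ A) B = valleys-++-d∷ A B
  valleys-++-d∷ (false ∷ []) B = refl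
  valleys-++-d∷ (false ∷ true ∷ A) B = cong suc (valleys-++-d∷ (true ∷ A) B)
  valleys-++-d∷ (false ∷ false ∷ A) B = valleys-++-d∷ (false ∷ A) B

  ddu-++-d∷ : ∀ A B → ddu (A ++ false ∷ B) ≡ lastD A * startsU B + (ddu A + ddu (false ∷ B))
  ddu-++-d∷ [] B = refl
  ddu-++-d∷ (true ∷ []) B = refl
  ddu-++-d∷ (true ∷ y ∷ A) B = ddu-++-d∷ (y ∷ A) B
  ddu-++-d∷ (false ∷ []) B = trans (ddu-dd∷ B) (cong (_+ ddu (false ∷ B)) (sym (+-identityʳ (startsU B))))
  ddu-++-d∷ (false ∷ true ∷ A) B = ddu-++-d∷ (true ∷ A) B
  ddu-++-d∷ (false ∷ false ∷ []) B = trans (ddu-dd∷ B) (cong (_+ ddu (false ∷ B)) (sym (+-identityʳ (startsU B))))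
  ddu-++-d∷ (false ∷ false ∷ true ∷ A) B = trans (cong suc (ddu-++-d∷ (false ∷ true ∷ A) B))
    (sym (+-suc (lastD (true ∷ A) * startsU B) (ddu (true ∷ A) + ddu (false ∷ B))))
  ddu-++-d∷ (false ∷ false ∷ false ∷ A) B = ddu-++-d∷ (false ∷ false ∷ A) B

  duu-++-d∷ : ∀ A B → duu (A ++ false ∷ B) ≡ duu A + duu (false ∷ B)
  duu-++-d∷ [] B = refl
  duu-++-d∷ (true ∷ A) B = duu-++-d∷ A B
  duu-++-d∷ (false ∷ []) B = refl
  duu-++-d∷ (false ∷ false ∷ A) B = duu-++-d∷ (false ∷ A) B
  duu-++-d∷ (false ∷ true ∷ []) B = refl
  duu-++-d∷ (false ∷ true ∷ true ∷ A) B = cong suc (duu-++-d∷ (true ∷ true ∷ A) B)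
  duu-++-d∷ (false ∷ true ∷ false ∷ A) B = duu-++-d∷ (true ∷ false ∷ A) B

  duu-d∷ : ∀ B → duu (false ∷ B) ≡ startsUU B + duu B
  duu-d∷ [] = refl
  duu-d∷ (true ∷ []) = refl
  duu-d∷ (true ∷ true ∷ w) = refl
  duu-d∷ (true ∷ false ∷ w) = refl
  duu-d∷ (false ∷ w) = refl

  startsU-++-d∷ : ∀ A B → startsU (A ++ false ∷ B) ≡ startsU A
  startsU-++-d∷ [] B = refl
  startsU-++-d∷ (true ∷ A) B = refl
  startsU-++-d∷ (false ∷ A) B = refl

  ddu-d∷-Balanced : ∀ {B} → Balanced 0 B → ddu (false ∷ B) ≡ ddu B
  ddu-d∷-Balanced done = refl
  ddu-d∷-Balanced (up _) = refl

  lastD-Balanced : ∀ {A} → Balanced 0 A → lastD A ≡ startsU A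
  lastD-Balanced done = refl
  lastD-Balanced (up p) = Balanced-lastD (up p)

  valleys*startsU : ∀ {B} → Balanced 0 B → valleys B * startsU B ≡ valleys B
  valleys*startsU done = refl
  valleys*startsU (up p) = *-identityʳ _

  startsU*startsU : ∀ B → startsU B * startsU B ≡ startsU B
  startsU*startsU [] = refl
  startsU*startsU (true ∷ _) = refl
  startsU*startsU (false ∷ _) = refl

  valleys-split : ∀ A B → valleys (true ∷ A ++ false ∷ B) ≡ valleys A + (startsU B + valleys B)
  valleys-split A B = trans (valleys-++-d∷ A B) (cong (valleys A +_) (valleys-d∷ B))

  ddu-split : ∀ {A B} → Balanced 0 A → Balanced 0 B → ddu (true ∷ A ++ false ∷ B) ≡ startsU A * startsU B + (ddu A + ddu B)
  ddu-split {A} {B} gA gB = trans (ddu-++-d∷ A B) (cong₂ (λ a b → a * startsU B + (ddu A + b)) (lastD-Balanced gA) (ddu-d∷-Balanced gB))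

  duu-split : ∀ A B → duu (true ∷ A ++ false ∷ B) ≡ duu A + (startsUU B + duu B)
  duu-split A B = trans (duu-++-d∷ A B) (cong (duu A +_) (duu-d∷ B))

  startsUU-split : ∀ A B → startsUU (true ∷ A ++ false ∷ B) ≡ startsU A
  startsUU-split A B = startsU-++-d∷ A B

  valleys²-split : ∀ {A B} → Balanced 0 B → valleys (true ∷ A ++ false ∷ B) * valleys (true ∷ A ++ false ∷ B) ≡
    valleys A * valleys A * 1 + 1 * (valleys B * valleys B) + 1 * startsU B + 2 * (valleys A * valleys B) + 2 * (valleys A * startsU B) + 2 * (1 * valleys B)
  valleys²-split {A} {B} gB = begin
    valleys (true ∷ A ++ false ∷ B) * valleys (true ∷ A ++ false ∷ B) ≡⟨ cong (λ z → z * z) (valleys-split A B) ⟩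
    (a + (h + b)) * (a + (h + b)) ≡⟨ l a h b ⟩
    a * a * 1 + 1 * (b * b) + 1 * (h * h) + 2 * (a * b) + 2 * (a * h) + 2 * (1 * (b * h)) ≡⟨ cong₂ (λ x y → a * a * 1 + 1 * (b * b) + 1 * x + 2 * (a * b) + 2 * (a * h) + 2 * (1 * y)) (startsU*startsU B) (valleys*startsU gB) ⟩
    a * a * 1 + 1 * (b * b) + 1 * h + 2 * (a * b) + 2 * (a * h) + 2 * (1 * b) ∎
    where
    open ≡-Reasoning
    a = valleys A
    b = valleys B
    h = startsU B
    l : ∀ a h b → (a + (h + b)) * (a + (h + b)) ≡ a * a * 1 + 1 * (b * b) + 1 * (h * h) + 2 * (a * b) + 2 * (a * h) + 2 * (1 * (b * h))
    l = NS.solve-∀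


module ConvolutionSums where

  open import Defs
  open PowerSeries
  open FiniteSums
  open BalancedWords
  open ValleyFlips
  open PatternCounts
  open ChainCount using (sumBy-*ʳ; sumBy-congD)
  open FirstReturn using (sumℕ; sumℕ-cong)
  open import Data.Bool using (true; false)
  open import Data.Nat as N using (ℕ; zero; suc; _∸_)
  import Data.Nat.Properties as NP
  open import Data.Integer as Z using (ℤ; +_)
  import Data.Integer.Properties as ZP
  open import Data.List using (List; _∷_; _++_)
  open import Relation.Binary.PropositionalEquality
  open import Function using (id)
  import Data.Nat.Tactic.RingSolver as NS

  Σd : ℕ → (Word → ℕ) → ℕ
  Σd k f = sumBy f (dyck k)

  sumBy² : List Word → List Word → (Word → Word → ℕ) → ℕ
  sumBy² L1 L2 F = sumBy (λ A → sumBy (λ B → F A B) L2) L1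

  sumBy²-+ : ∀ L1 L2 F G → sumBy² L1 L2 (λ A B → F A B N.+ G A B) ≡ sumBy² L1 L2 F N.+ sumBy² L1 L2 G
  sumBy²-+ L1 L2 F G = trans (sumBy-cong L1 (λ A → sumBy-+ (F A) (G A) L2)) (sumBy-+ _ _ L1)

  sumBy²-bilinear : ∀ L1 L2 (α β : Word → ℕ) → sumBy² L1 L2 (λ A B → α A N.* β B) ≡ sumBy α L1 N.* sumBy β L2
  sumBy²-bilinear L1 L2 α β = trans (sumBy-cong L1 (λ A → sumBy-* (α A) β L2)) (sym (sumBy-*ʳ α L1 (sumBy β L2)))

  sumBy²-* : ∀ L1 L2 c F → sumBy² L1 L2 (λ A B → c N.* F A B) ≡ c N.* sumBy² L1 L2 F
  sumBy²-* L1 L2 c F = trans (sumBy-cong L1 (λ A → sumBy-* c (F A) L2)) (sumBy-* c _ L1)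

  sumBy²-congD : ∀ i j (F G : Word → Word → ℕ) → (∀ A B → IsDyck i A → IsDyck j B → F A B ≡ G A B) → sumBy² (dyck i) (dyck j) F ≡ sumBy² (dyck i) (dyck j) G
  sumBy²-congD i j F G p = sumBy-congD i _ _ (λ A dA → sumBy-congD j _ _ (λ B dB → p A B dA dB))

  sumℕ-+ : ∀ m (f g : ℕ → ℕ) → sumℕ m (λ i → f i N.+ g i) ≡ sumℕ m f N.+ sumℕ m g
  sumℕ-+ zero f g = refl
  sumℕ-+ (suc m) f g = trans (cong (f 0 N.+ g 0 N.+_) (sumℕ-+ m (λ i → f (suc i)) (λ i → g (suc i))))
    (l (f 0) (g 0) (sumℕ m (λ i → f (suc i))) (sumℕ m (λ i → g (suc i))))
    where
    l : ∀ a b c d → a N.+ b N.+ (c N.+ d) ≡ a N.+ c N.+ (b N.+ d)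
    l = NS.solve-∀

  sumℕ-* : ∀ m c (f : ℕ → ℕ) → sumℕ m (λ i → c N.* f i) ≡ c N.* sumℕ m f
  sumℕ-* zero c f = sym (NP.*-zeroʳ c)
  sumℕ-* (suc m) c f = trans (cong (c N.* f 0 N.+_) (sumℕ-* m c (λ i → f (suc i)))) (sym (NP.*-distribˡ-+ c (f 0) _))

  ⟪_⟫ : (ℕ → ℕ) → Series
  ⟪ a ⟫ k = + a k

  pos-sumℕ : ∀ m (F : ℕ → ℕ) → + sumℕ m F ≡ sumTo m (λ i → + F i)
  pos-sumℕ zero F = refl
  pos-sumℕ (suc m) F = trans (ZP.pos-+ (F 0) _) (cong (Z._+_ (+ F 0)) (pos-sumℕ m (λ i → F (suc i))))

  sumℕ-⋆ : ∀ (a b : ℕ → ℕ) n → + sumℕ (suc n) (λ i → a i N.* b (n ∸ i)) ≡ (⟪ a ⟫ ⋆ ⟪ b ⟫) n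
  sumℕ-⋆ a b n = trans (pos-sumℕ (suc n) (λ i → a i N.* b (n ∸ i))) (trans (sumTo-cong (suc n) (λ i → ZP.pos-* (a i) (b (n ∸ i))))
    (sym (sum-apply (λ i → + a i Z.* + b (n ∸ i)) id (suc n))))
    where
    sumTo-cong : ∀ m {F G : ℕ → ℤ} → (∀ i → F i ≡ G i) → sumTo m F ≡ sumTo m G
    sumTo-cong zero p = refl
    sumTo-cong (suc m) p = cong₂ Z._+_ (p 0) (sumTo-cong m (λ i → p (suc i)))

  dyckCount valleySum valley²Sum dduSum duuSum startsUSum startsUUSum : ℕ → ℕ
  dyckCount k = Σd k (λ _ → 1)
  valleySum k = Σd k valleys
  valley²Sum k = Σd k (λ w → valleys w N.* valleys w)
  dduSum k = Σd k ddu
  duuSum k = Σd k duu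
  startsUSum k = Σd k startsU
  startsUUSum k = Σd k startsUU

  splitSum : ℕ → (Word → ℕ) → ℕ → ℕ → ℕ
  splitSum n f i j = sumBy² (dyck i) (dyck j) (λ A B → f (true ∷ A ++ false ∷ B))

  sumℕ-convolution₁ : ∀ n (P : ℕ → ℕ → ℕ) a1 b1 → (∀ i j → P i j ≡ a1 i N.* b1 j) →
    + sumℕ (suc n) (λ i → P i (n ∸ i)) ≡ (⟪ a1 ⟫ ⋆ ⟪ b1 ⟫) n
  sumℕ-convolution₁ n P a1 b1 p = trans (cong +_ (sumℕ-cong (suc n) (λ i _ → p i (n ∸ i)))) (sumℕ-⋆ a1 b1 n)

  sumℕ-convolution₃ : ∀ n (P : ℕ → ℕ → ℕ) a1 b1 a2 b2 a3 b3 → (∀ i j → P i j ≡ a1 i N.* b1 j N.+ a2 i N.* b2 j N.+ a3 i N.* b3 j) →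
    + sumℕ (suc n) (λ i → P i (n ∸ i)) ≡ ((⟪ a1 ⟫ ⋆ ⟪ b1 ⟫) ⊕ (⟪ a2 ⟫ ⋆ ⟪ b2 ⟫) ⊕ (⟪ a3 ⟫ ⋆ ⟪ b3 ⟫)) n
  sumℕ-convolution₃ n P a1 b1 a2 b2 a3 b3 p = begin
    + sumℕ (suc n) (λ i → P i (n ∸ i)) ≡⟨ cong +_ (sumℕ-cong (suc n) (λ i _ → p i (n ∸ i))) ⟩
    + sumℕ (suc n) (λ i → F1 i N.+ F2 i N.+ F3 i) ≡⟨ cong +_ (trans (sumℕ-+ (suc n) (λ i → F1 i N.+ F2 i) F3) (cong (N._+ sumℕ (suc n) F3) (sumℕ-+ (suc n) F1 F2))) ⟩
    + (sumℕ (suc n) F1 N.+ sumℕ (suc n) F2 N.+ sumℕ (suc n) F3) ≡⟨ trans (ZP.pos-+ (sumℕ (suc n) F1 N.+ sumℕ (suc n) F2) (sumℕ (suc n) F3)) (cong (Z._+ + sumℕ (suc n) F3) (ZP.pos-+ (sumℕ (suc n) F1) (sumℕ (suc n) F2))) ⟩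
    + sumℕ (suc n) F1 Z.+ + sumℕ (suc n) F2 Z.+ + sumℕ (suc n) F3 ≡⟨ cong₂ Z._+_ (cong₂ Z._+_ (sumℕ-⋆ a1 b1 n) (sumℕ-⋆ a2 b2 n)) (sumℕ-⋆ a3 b3 n) ⟩
    ((⟪ a1 ⟫ ⋆ ⟪ b1 ⟫) ⊕ (⟪ a2 ⟫ ⋆ ⟪ b2 ⟫) ⊕ (⟪ a3 ⟫ ⋆ ⟪ b3 ⟫)) n ∎
    where
    open ≡-Reasoning
    F1 = λ i → a1 i N.* b1 (n ∸ i)
    F2 = λ i → a2 i N.* b2 (n ∸ i)
    F3 = λ i → a3 i N.* b3 (n ∸ i)

  sumℕ-2⋆ : ∀ (a b : ℕ → ℕ) n → + sumℕ (suc n) (λ i → 2 N.* (a i N.* b (n ∸ i))) ≡ scale (+ 2) (⟪ a ⟫ ⋆ ⟪ b ⟫) n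
  sumℕ-2⋆ a b n = trans (cong +_ (sumℕ-* (suc n) 2 (λ i → a i N.* b (n ∸ i)))) (trans (ZP.pos-* 2 (sumℕ (suc n) (λ i → a i N.* b (n ∸ i)))) (cong (Z._*_ (+ 2)) (sumℕ-⋆ a b n)))

  sumℕ-convolution₆ : ∀ n (P : ℕ → ℕ → ℕ) a1 b1 a2 b2 a3 b3 a4 b4 a5 b5 a6 b6 →
    (∀ i j → P i j ≡ a1 i N.* b1 j N.+ a2 i N.* b2 j N.+ a3 i N.* b3 j N.+ 2 N.* (a4 i N.* b4 j) N.+ 2 N.* (a5 i N.* b5 j) N.+ 2 N.* (a6 i N.* b6 j)) →
    + sumℕ (suc n) (λ i → P i (n ∸ i)) ≡ ((⟪ a1 ⟫ ⋆ ⟪ b1 ⟫) ⊕ (⟪ a2 ⟫ ⋆ ⟪ b2 ⟫) ⊕ (⟪ a3 ⟫ ⋆ ⟪ b3 ⟫) ⊕ scale (+ 2) (⟪ a4 ⟫ ⋆ ⟪ b4 ⟫) ⊕ scale (+ 2) (⟪ a5 ⟫ ⋆ ⟪ b5 ⟫) ⊕ scale (+ 2) (⟪ a6 ⟫ ⋆ ⟪ b6 ⟫)) n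
  sumℕ-convolution₆ n P a1 b1 a2 b2 a3 b3 a4 b4 a5 b5 a6 b6 p = begin
    + sumℕ (suc n) (λ i → P i (n ∸ i)) ≡⟨ cong +_ (sumℕ-cong (suc n) (λ i _ → p i (n ∸ i))) ⟩
    + sumℕ (suc n) (λ i → F1 i N.+ F2 i N.+ F3 i N.+ F4 i N.+ F5 i N.+ F6 i)
      ≡⟨ cong +_ (trans (sumℕ-+ (suc n) G5 F6) (cong (N._+ sumℕ (suc n) F6) (trans (sumℕ-+ (suc n) G4 F5) (cong (N._+ sumℕ (suc n) F5)
          (trans (sumℕ-+ (suc n) G3 F4) (cong (N._+ sumℕ (suc n) F4) (trans (sumℕ-+ (suc n) G2 F3) (cong (N._+ sumℕ (suc n) F3) (sumℕ-+ (suc n) F1 F2))))))))) ⟩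
    + (S1 N.+ S2 N.+ S3 N.+ S4 N.+ S5 N.+ S6)
      ≡⟨ trans (ZP.pos-+ (S1 N.+ S2 N.+ S3 N.+ S4 N.+ S5) S6) (cong (Z._+ + S6) (trans (ZP.pos-+ (S1 N.+ S2 N.+ S3 N.+ S4) S5) (cong (Z._+ + S5)
          (trans (ZP.pos-+ (S1 N.+ S2 N.+ S3) S4) (cong (Z._+ + S4) (trans (ZP.pos-+ (S1 N.+ S2) S3) (cong (Z._+ + S3) (ZP.pos-+ S1 S2)))))))) ⟩
    + sumℕ (suc n) F1 Z.+ + sumℕ (suc n) F2 Z.+ + sumℕ (suc n) F3 Z.+ + sumℕ (suc n) F4 Z.+ + sumℕ (suc n) F5 Z.+ + sumℕ (suc n) F6
      ≡⟨ cong₂ Z._+_ (cong₂ Z._+_ (cong₂ Z._+_ (cong₂ Z._+_ (cong₂ Z._+_ (sumℕ-⋆ a1 b1 n) (sumℕ-⋆ a2 b2 n)) (sumℕ-⋆ a3 b3 n))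
            (sumℕ-2⋆ a4 b4 n)) (sumℕ-2⋆ a5 b5 n)) (sumℕ-2⋆ a6 b6 n) ⟩
    ((⟪ a1 ⟫ ⋆ ⟪ b1 ⟫) ⊕ (⟪ a2 ⟫ ⋆ ⟪ b2 ⟫) ⊕ (⟪ a3 ⟫ ⋆ ⟪ b3 ⟫) ⊕ scale (+ 2) (⟪ a4 ⟫ ⋆ ⟪ b4 ⟫) ⊕ scale (+ 2) (⟪ a5 ⟫ ⋆ ⟪ b5 ⟫) ⊕ scale (+ 2) (⟪ a6 ⟫ ⋆ ⟪ b6 ⟫)) n ∎
    where
    open ≡-Reasoning
    F1 = λ i → a1 i N.* b1 (n ∸ i)
    F2 = λ i → a2 i N.* b2 (n ∸ i)
    F3 = λ i → a3 i N.* b3 (n ∸ i)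
    F4 = λ i → 2 N.* (a4 i N.* b4 (n ∸ i))
    F5 = λ i → 2 N.* (a5 i N.* b5 (n ∸ i))
    F6 = λ i → 2 N.* (a6 i N.* b6 (n ∸ i))
    G2 = λ i → F1 i N.+ F2 i
    G3 = λ i → G2 i N.+ F3 i
    G4 = λ i → G3 i N.+ F4 i
    G5 = λ i → G4 i N.+ F5 i
    S1 = sumℕ (suc n) F1
    S2 = sumℕ (suc n) F2
    S3 = sumℕ (suc n) F3
    S4 = sumℕ (suc n) F4
    S5 = sumℕ (suc n) F5
    S6 = sumℕ (suc n) F6


module FunctionalEquations where

  open import Defs
  open PowerSeries
  open FiniteSums
  open BalancedWords
  open ValleyFlips
  open PatternCounts
  open ConvolutionSums
  open ChainCount using (sumBy-congD; sc2+Σvalleys)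
  open FirstReturn using (sumBy-dyck-suc)
  open import Data.Nat as N using (ℕ; suc)
  import Data.Nat.Properties as NP
  open import Data.Integer as Z using (+_)
  import Data.Integer.Properties as ZP
  open import Relation.Binary.PropositionalEquality
  import Data.Nat.Tactic.RingSolver as NS

  sumBy²-bilinear₃ : ∀ L1 L2 (a1 b1 a2 b2 a3 b3 : Word → ℕ) →
    sumBy² L1 L2 (λ A B → a1 A N.* b1 B N.+ a2 A N.* b2 B N.+ a3 A N.* b3 B) ≡
    sumBy a1 L1 N.* sumBy b1 L2 N.+ sumBy a2 L1 N.* sumBy b2 L2 N.+ sumBy a3 L1 N.* sumBy b3 L2
  sumBy²-bilinear₃ L1 L2 a1 b1 a2 b2 a3 b3 = trans (sumBy²-+ L1 L2 (λ A B → a1 A N.* b1 B N.+ a2 A N.* b2 B) (λ A B → a3 A N.* b3 B))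
    (cong₂ N._+_ (trans (sumBy²-+ L1 L2 (λ A B → a1 A N.* b1 B) (λ A B → a2 A N.* b2 B)) (cong₂ N._+_ (sumBy²-bilinear L1 L2 a1 b1) (sumBy²-bilinear L1 L2 a2 b2)))
      (sumBy²-bilinear L1 L2 a3 b3))

  sumBy²-2bilinear : ∀ L1 L2 (a b : Word → ℕ) → sumBy² L1 L2 (λ A B → 2 N.* (a A N.* b B)) ≡ 2 N.* (sumBy a L1 N.* sumBy b L2)
  sumBy²-2bilinear L1 L2 a b = trans (sumBy²-* L1 L2 2 (λ A B → a A N.* b B)) (cong (2 N.*_) (sumBy²-bilinear L1 L2 a b))

  sumBy²-bilinear₆ : ∀ L1 L2 (a1 b1 a2 b2 a3 b3 a4 b4 a5 b5 a6 b6 : Word → ℕ) →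
    sumBy² L1 L2 (λ A B → a1 A N.* b1 B N.+ a2 A N.* b2 B N.+ a3 A N.* b3 B N.+ 2 N.* (a4 A N.* b4 B) N.+ 2 N.* (a5 A N.* b5 B) N.+ 2 N.* (a6 A N.* b6 B)) ≡
    sumBy a1 L1 N.* sumBy b1 L2 N.+ sumBy a2 L1 N.* sumBy b2 L2 N.+ sumBy a3 L1 N.* sumBy b3 L2 N.+ 2 N.* (sumBy a4 L1 N.* sumBy b4 L2) N.+ 2 N.* (sumBy a5 L1 N.* sumBy b5 L2) N.+ 2 N.* (sumBy a6 L1 N.* sumBy b6 L2)
  sumBy²-bilinear₆ L1 L2 a1 b1 a2 b2 a3 b3 a4 b4 a5 b5 a6 b6 =
    trans (sumBy²-+ L1 L2 (λ A B → a1 A N.* b1 B N.+ a2 A N.* b2 B N.+ a3 A N.* b3 B N.+ 2 N.* (a4 A N.* b4 B) N.+ 2 N.* (a5 A N.* b5 B)) (λ A B → 2 N.* (a6 A N.* b6 B)))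
    (cong₂ N._+_ (trans (sumBy²-+ L1 L2 (λ A B → a1 A N.* b1 B N.+ a2 A N.* b2 B N.+ a3 A N.* b3 B N.+ 2 N.* (a4 A N.* b4 B)) (λ A B → 2 N.* (a5 A N.* b5 B)))
      (cong₂ N._+_ (trans (sumBy²-+ L1 L2 (λ A B → a1 A N.* b1 B N.+ a2 A N.* b2 B N.+ a3 A N.* b3 B) (λ A B → 2 N.* (a4 A N.* b4 B)))
        (cong₂ N._+_ (sumBy²-bilinear₃ L1 L2 a1 b1 a2 b2 a3 b3) (sumBy²-2bilinear L1 L2 a4 b4)))
        (sumBy²-2bilinear L1 L2 a5 b5)))
      (sumBy²-2bilinear L1 L2 a6 b6))

  one : Word → ℕ
  one _ = 1

  split-count : ∀ n i j → splitSum n one i j ≡ dyckCount i N.* dyckCount j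
  split-count n i j = sumBy²-bilinear (dyck i) (dyck j) one one

  split-valleys : ∀ n i j → splitSum n valleys i j ≡ valleySum i N.* dyckCount j N.+ dyckCount i N.* valleySum j N.+ dyckCount i N.* startsUSum j
  split-valleys n i j = trans (sumBy²-congD i j _ (λ A B → valleys A N.* 1 N.+ 1 N.* valleys B N.+ 1 N.* startsU B)
      (λ A B _ _ → trans (valleys-split A B) (l (valleys A) (startsU B) (valleys B))))
    (sumBy²-bilinear₃ (dyck i) (dyck j) valleys one one valleys one startsU)
    where
    l : ∀ a h b → a N.+ (h N.+ b) ≡ a N.* 1 N.+ 1 N.* b N.+ 1 N.* h
    l = NS.solve-∀

  split-valleys² : ∀ n i j → splitSum n (λ w → valleys w N.* valleys w) i j ≡
    valley²Sum i N.* dyckCount j N.+ dyckCount i N.* valley²Sum j N.+ dyckCount i N.* startsUSum j N.+ 2 N.* (valleySum i N.* valleySum j) N.+ 2 N.* (valleySum i N.* startsUSum j) N.+ 2 N.* (dyckCount i N.* valleySum j)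
  split-valleys² n i j = trans (sumBy²-congD i j _ _ (λ A B _ dB → valleys²-split {A} {B} (Dyck⇒Balanced dB)))
    (sumBy²-bilinear₆ (dyck i) (dyck j) (λ w → valleys w N.* valleys w) one one (λ w → valleys w N.* valleys w) one startsU valleys valleys valleys startsU one valleys)

  split-ddu : ∀ n i j → splitSum n ddu i j ≡ dduSum i N.* dyckCount j N.+ dyckCount i N.* dduSum j N.+ startsUSum i N.* startsUSum j
  split-ddu n i j = trans (sumBy²-congD i j _ (λ A B → ddu A N.* 1 N.+ 1 N.* ddu B N.+ startsU A N.* startsU B)
      (λ A B dA dB → trans (ddu-split (Dyck⇒Balanced dA) (Dyck⇒Balanced dB)) (l (startsU A N.* startsU B) (ddu A) (ddu B))))
    (sumBy²-bilinear₃ (dyck i) (dyck j) ddu one one ddu startsU startsU)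
    where
    l : ∀ x a b → x N.+ (a N.+ b) ≡ a N.* 1 N.+ 1 N.* b N.+ x
    l = NS.solve-∀

  split-duu : ∀ n i j → splitSum n duu i j ≡ duuSum i N.* dyckCount j N.+ dyckCount i N.* duuSum j N.+ dyckCount i N.* startsUUSum j
  split-duu n i j = trans (sumBy²-congD i j _ (λ A B → duu A N.* 1 N.+ 1 N.* duu B N.+ 1 N.* startsUU B)
      (λ A B _ _ → trans (duu-split A B) (l (duu A) (startsUU B) (duu B))))
    (sumBy²-bilinear₃ (dyck i) (dyck j) duu one one duu one startsUU)
    where
    l : ∀ a s b → a N.+ (s N.+ b) ≡ a N.* 1 N.+ 1 N.* b N.+ 1 N.* s
    l = NS.solve-∀

  split-startsUU : ∀ n i j → splitSum n startsUU i j ≡ startsUSum i N.* dyckCount j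
  split-startsUU n i j = trans (sumBy²-congD i j _ (λ A B → startsU A N.* 1) (λ A B _ _ → trans (startsUU-split A B) (sym (NP.*-identityʳ (startsU A)))))
    (sumBy²-bilinear (dyck i) (dyck j) startsU one)

  -- Generating series of |𝒟ₙ| and of the sums over 𝒟ₙ of val, val², #ddu, #duu, [starts with u]
  -- and [starts with uu]; the first-return decomposition u A d B makes each satisfy an algebraic equation.
  Cs V1 V2 T U Hs Y : Series
  Cs = ⟪ dyckCount ⟫
  V1 = ⟪ valleySum ⟫
  V2 = ⟪ valley²Sum ⟫
  T = ⟪ dduSum ⟫
  U = ⟪ duuSum ⟫
  Hs = ⟪ startsUSum ⟫
  Y = ⟪ startsUUSum ⟫

  Cs-suc : ∀ n → Cs (suc n) ≡ (Cs ⋆ Cs) n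
  Cs-suc n = trans (cong +_ (sumBy-dyck-suc n one)) (sumℕ-convolution₁ n (splitSum n one) dyckCount dyckCount (split-count n))

  V1-suc : ∀ n → V1 (suc n) ≡ ((V1 ⋆ Cs) ⊕ (Cs ⋆ V1) ⊕ (Cs ⋆ Hs)) n
  V1-suc n = trans (cong +_ (sumBy-dyck-suc n valleys)) (sumℕ-convolution₃ n (splitSum n valleys) valleySum dyckCount dyckCount valleySum dyckCount startsUSum (split-valleys n))

  V2-suc : ∀ n → V2 (suc n) ≡ ((V2 ⋆ Cs) ⊕ (Cs ⋆ V2) ⊕ (Cs ⋆ Hs) ⊕ scale (+ 2) (V1 ⋆ V1) ⊕ scale (+ 2) (V1 ⋆ Hs) ⊕ scale (+ 2) (Cs ⋆ V1)) n
  V2-suc n = trans (cong +_ (sumBy-dyck-suc n (λ w → valleys w N.* valleys w))) (sumℕ-convolution₆ n (splitSum n (λ w → valleys w N.* valleys w)) valley²Sum dyckCount dyckCount valley²Sum dyckCount startsUSum valleySum valleySum valleySum startsUSum dyckCount valleySum (split-valleys² n))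

  T-suc : ∀ n → T (suc n) ≡ ((T ⋆ Cs) ⊕ (Cs ⋆ T) ⊕ (Hs ⋆ Hs)) n
  T-suc n = trans (cong +_ (sumBy-dyck-suc n ddu)) (sumℕ-convolution₃ n (splitSum n ddu) dduSum dyckCount dyckCount dduSum startsUSum startsUSum (split-ddu n))

  U-suc : ∀ n → U (suc n) ≡ ((U ⋆ Cs) ⊕ (Cs ⋆ U) ⊕ (Cs ⋆ Y)) n
  U-suc n = trans (cong +_ (sumBy-dyck-suc n duu)) (sumℕ-convolution₃ n (splitSum n duu) duuSum dyckCount dyckCount duuSum dyckCount startsUUSum (split-duu n))

  Y-suc : ∀ n → Y (suc n) ≡ (Hs ⋆ Cs) n
  Y-suc n = trans (cong +_ (sumBy-dyck-suc n startsUU)) (sumℕ-convolution₁ n (splitSum n startsUU) startsUSum dyckCount (split-startsUU n))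

  Hs-suc : ∀ n → Hs (suc n) ≡ Cs (suc n)
  Hs-suc n = cong +_ (sumBy-congD (suc n) startsU one h1)
    where
    h1 : ∀ w → IsDyck (suc n) w → startsU w ≡ 1
    h1 w d with Dyck⇒Balanced d | Dyck⇒len d
    ... | up _ | _ = refl

  SC2+V1 : ∀ n → SC2 n Z.+ V1 n ≡ V2 n Z.+ T n Z.+ U n
  SC2+V1 n = trans (sym (ZP.pos-+ (sc2 n) (valleySum n))) (trans (cong +_ (trans (sc2+Σvalleys n)
    (trans (sumBy-+ (λ a → valleys a N.* valleys a N.+ ddu a) duu (dyck n)) (cong (N._+ duuSum n) (sumBy-+ (λ a → valleys a N.* valleys a) ddu (dyck n))))))
    (trans (ZP.pos-+ (valley²Sum n N.+ dduSum n) (duuSum n)) (cong (Z._+ U n) (ZP.pos-+ (valley²Sum n) (dduSum n)))))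


module Elimination where

  open import Defs
  open PowerSeries
  open PowerSeriesRing
  open FunctionalEquations
  open import Data.Nat using (zero; suc)
  open import Data.Fin using (zero; suc)
  open import Data.Integer as Z using (+_; 1ℤ)
  import Data.Integer.Properties as ZP
  open import Data.List using ([]; _∷_)
  open import Data.Vec using (Vec; []; _∷_)
  open import Data.List.Relation.Unary.All using ([]; _∷_)
  open import Relation.Binary.PropositionalEquality as P using (refl; cong₂)
  open import Data.Product using (_,_)
  open import Relation.Binary.Reasoning.Setoid setoid

  Cs-equation : Cs ≈ κ 1ℤ ⊕ X ⋆ (Cs ⋆ Cs)
  Cs-equation = ≈κ⊕X⋆ Cs (Cs ⋆ Cs) 1ℤ refl Cs-suc

  Hs-equation : Hs ≈ Cs ⊕ neg (κ 1ℤ)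
  Hs-equation = mk λ { zero → refl ; (suc n) → P.trans (Hs-suc n) (P.sym (ZP.+-identityʳ _)) }

  V1-equation : V1 ≈ X ⋆ ((V1 ⋆ Cs) ⊕ (Cs ⋆ V1) ⊕ (Cs ⋆ Hs))
  V1-equation = ≈X⋆ V1 _ refl V1-suc

  V2-equation : V2 ≈ X ⋆ ((V2 ⋆ Cs) ⊕ (Cs ⋆ V2) ⊕ (Cs ⋆ Hs) ⊕ κ (+ 2) ⋆ (V1 ⋆ V1) ⊕ κ (+ 2) ⋆ (V1 ⋆ Hs) ⊕ κ (+ 2) ⋆ (Cs ⋆ V1))
  V2-equation = ≈X⋆ V2 _ refl (λ n → P.trans (V2-suc n)
    (cong₂ Z._+_ (cong₂ Z._+_ (cong₂ Z._+_ (refl {x = ((V2 ⋆ Cs) ⊕ (Cs ⋆ V2) ⊕ (Cs ⋆ Hs)) n})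
      (P.sym (κ⋆ (+ 2) (V1 ⋆ V1) n))) (P.sym (κ⋆ (+ 2) (V1 ⋆ Hs) n))) (P.sym (κ⋆ (+ 2) (Cs ⋆ V1) n))))

  T-equation : T ≈ X ⋆ ((T ⋆ Cs) ⊕ (Cs ⋆ T) ⊕ (Hs ⋆ Hs))
  T-equation = ≈X⋆ T _ refl T-suc

  U-equation : U ≈ X ⋆ ((U ⋆ Cs) ⊕ (Cs ⋆ U) ⊕ (Cs ⋆ Y))
  U-equation = ≈X⋆ U _ refl U-suc

  Y-equation : Y ≈ X ⋆ (Hs ⋆ Cs)
  Y-equation = ≈X⋆ Y _ refl Y-suc

  SC2-equation : SC2 ⊕ V1 ≈ V2 ⊕ T ⊕ U
  SC2-equation = mk SC2+V1

  vx vc vh vv1 vv2 vt vu vy vsc vs : Polynomial 10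
  vx = var zero
  vc = var (suc zero)
  vh = var (suc (suc zero))
  vv1 = var (suc (suc (suc zero)))
  vv2 = var (suc (suc (suc (suc zero))))
  vt = var (suc (suc (suc (suc (suc zero)))))
  vu = var (suc (suc (suc (suc (suc (suc zero))))))
  vy = var (suc (suc (suc (suc (suc (suc (suc zero)))))))
  vsc = var (suc (suc (suc (suc (suc (suc (suc (suc zero))))))))
  vs = var (suc (suc (suc (suc (suc (suc (suc (suc (suc zero)))))))))

  ρ : Series → Vec Series 10
  ρ s = X ∷ Cs ∷ Hs ∷ V1 ∷ V2 ∷ T ∷ U ∷ Y ∷ SC2 ∷ s ∷ []

  relC relH relV1 relV2 relT relU relY relSC relS relQ relA : Polynomial 10
  relC = vc :- (con 1ℤ :+ vx :* (vc :* vc))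
  relH = vh :- (vc :- con 1ℤ)
  relV1 = vv1 :- vx :* ((vv1 :* vc :+ vc :* vv1) :+ vc :* vh)
  relV2 = vv2 :- vx :* (((((vv2 :* vc :+ vc :* vv2) :+ vc :* vh) :+ con (+ 2) :* (vv1 :* vv1)) :+ con (+ 2) :* (vv1 :* vh)) :+ con (+ 2) :* (vc :* vv1))
  relT = vt :- vx :* ((vt :* vc :+ vc :* vt) :+ vh :* vh)
  relU = vu :- vx :* ((vu :* vc :+ vc :* vu) :+ vc :* vy)
  relY = vy :- vx :* (vh :* vc)
  relSC = (vsc :+ vv1) :- ((vv2 :+ vt) :+ vu)
  relS = vs :- (con 1ℤ :- con (+ 2) :* vx :* vc)
  relQ = vs :* vs :- (con 1ℤ :+ con (Z.- (+ 4)) :* vx)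
  relA = vv1 :* vs :- vx :* vc :* vh

  s₀ : Series
  s₀ = κ 1ℤ ⊕ neg ((κ (+ 2) ⋆ X) ⋆ Cs)

  Q-in-X : Series
  Q-in-X = κ 1ℤ ⊕ κ (Z.- (+ 4)) ⋆ X

  relC-holds : ∀ s → ⟦ relC ⟧ (ρ s) ≈ 𝟘
  relC-holds s = ≈⇒difference≈𝟘 _ _ Cs-equation
  relH-holds : ∀ s → ⟦ relH ⟧ (ρ s) ≈ 𝟘
  relH-holds s = ≈⇒difference≈𝟘 _ _ Hs-equation
  relV1-holds : ∀ s → ⟦ relV1 ⟧ (ρ s) ≈ 𝟘
  relV1-holds s = ≈⇒difference≈𝟘 _ _ V1-equation
  relV2-holds : ∀ s → ⟦ relV2 ⟧ (ρ s) ≈ 𝟘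
  relV2-holds s = ≈⇒difference≈𝟘 _ _ V2-equation
  relT-holds : ∀ s → ⟦ relT ⟧ (ρ s) ≈ 𝟘
  relT-holds s = ≈⇒difference≈𝟘 _ _ T-equation
  relU-holds : ∀ s → ⟦ relU ⟧ (ρ s) ≈ 𝟘
  relU-holds s = ≈⇒difference≈𝟘 _ _ U-equation
  relY-holds : ∀ s → ⟦ relY ⟧ (ρ s) ≈ 𝟘
  relY-holds s = ≈⇒difference≈𝟘 _ _ Y-equation
  relSC-holds : ∀ s → ⟦ relSC ⟧ (ρ s) ≈ 𝟘
  relSC-holds s = ≈⇒difference≈𝟘 _ _ SC2-equation

  s₀² : s₀ ⋆ s₀ ≈ Q-in-X
  s₀² = ≈-modulo (ρ 𝟘) ((con 1ℤ :- con (+ 2) :* vx :* vc) :* (con 1ℤ :- con (+ 2) :* vx :* vc)) (con 1ℤ :+ con (Z.- (+ 4)) :* vx)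
    ((con (Z.- (+ 4)) :* vx , relC) ∷ []) ≈refl (relC-holds 𝟘 ∷ [])


module GeneratingFunction where

  open import Defs
  open PowerSeries
  open PowerSeriesRing
  open SquareRoot using (Q; regular-2)
  open FunctionalEquations
  open Elimination
  open import Data.Nat using (zero; suc)
  open import Data.Integer as Z using (+_; 0ℤ; 1ℤ; -1ℤ)
  import Data.Integer.Properties as ZP
  open import Data.List using (List; []; _∷_)
  open import Data.List.Relation.Unary.All using ([]; _∷_)
  open import Relation.Binary.PropositionalEquality as P using (_≡_; refl; cong; cong₂)
  open import Data.Product using (_,_; _×_)
  open import Relation.Binary.Reasoning.Setoid setoid

  Q≈Q-in-X : Q ≈ Q-in-X
  Q≈Q-in-X = mk λ { zero → refl ; (suc zero) → P.sym (P.trans (ZP.+-identityˡ _) (κ⋆ (Z.- (+ 4)) X 1)) ;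
               (suc (suc k)) → P.sym (P.trans (ZP.+-identityˡ _) (P.trans (κ⋆ (Z.- (+ 4)) X (suc (suc k))) (ZP.*-zeroʳ (Z.- (+ 4))))) }

  s₀-poly : Polynomial 10
  s₀-poly = con 1ℤ :- con (+ 2) :* vx :* vc

  module WithRoot (s : Series) (s0 : s 0 ≡ 1ℤ) (ss : s ⋆ s ≈ Q) where

    relQ-holds : ⟦ relQ ⟧ (ρ s) ≈ 𝟘
    relQ-holds = ≈⇒difference≈𝟘 (s ⋆ s) Q-in-X (≈trans ss Q≈Q-in-X)

    -- Both s and s₀ square to 1 - 4x, and s + s₀ has the regular constant term 2.
    relS-holds : ⟦ relS ⟧ (ρ s) ≈ 𝟘
    relS-holds = ⋆-cancel (s ⊕ neg s₀) (s ⊕ s₀) (+ 2) (cong (λ z → z Z.+ s₀ 0) s0) regular-2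
      (≈trans (≈-modulo (ρ s) ((vs :- s₀-poly) :* (vs :+ s₀-poly)) (con 0ℤ) ((con 1ℤ , relQ) ∷ (con (+ 4) :* vx , relC) ∷ []) ≈refl (relQ-holds ∷ relC-holds s ∷ [])) κ0)

    relA-holds : ⟦ relA ⟧ (ρ s) ≈ 𝟘
    relA-holds = ≈⇒difference≈𝟘 (V1 ⋆ s) ((X ⋆ Cs) ⋆ Hs) (≈-modulo (ρ s) (vv1 :* vs) (vx :* vc :* vh) ((con 1ℤ , relV1) ∷ (vv1 , relS) ∷ []) ≈refl (relV1-holds s ∷ relS-holds ∷ []))

    -- Cofactors expressing lhs - rhs in the ideal of the relations, found by polynomial division;
    -- the ring solver only checks the resulting identity.
    sc2-certificate : List (Polynomial 10 × Polynomial 10)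
    sc2-certificate =
      ((con (+ 1) :* vsc :* vs) , relQ) ∷
      ((con (Z.- (+ 1)) :* (vs :^ 3)) , relSC) ∷
      ((con (Z.- (+ 1)) :* (vs :^ 2)) , relV2) ∷
      ((con (Z.- (+ 1)) :* (vs :^ 2)) , relT) ∷
      ((con (Z.- (+ 1)) :* (vs :^ 2)) , relU) ∷
      ((con (Z.- (+ 1)) :* vx :* vc :* (vs :^ 2)) , relY) ∷
      ((((((con (+ 1) :* (vs :^ 2)) :+ (con (Z.- (+ 2)) :* vx :* vv1 :* vs)) :+ (con (Z.- (+ 2)) :* vx :* vh :* vs)) :+ (con (Z.- (+ 2)) :* vx :* vc :* vs)) :+ (con (Z.- (+ 2)) :* (vx :^ 2) :* vc :* vh)) , relA) ∷
      (((((((((((((((((con (+ 1)) :+ (con (Z.- (+ 1)) :* vu :* (vs :^ 2))) :+ (con (Z.- (+ 1)) :* vt :* (vs :^ 2))) :+ (con (Z.- (+ 1)) :* vv2 :* (vs :^ 2))) :+ (con (Z.- (+ 5)) :* vx)) :+ (con (Z.- (+ 1)) :* vx :* vs)) :+ (con (+ 2) :* vx :* vc)) :+ (con (+ 2) :* vx :* vc :* vs)) :+ (con (Z.- (+ 1)) :* vx :* (vc :^ 2))) :+ (con (Z.- (+ 1)) :* vx :* (vc :^ 2) :* vs)) :+ (con (+ 3) :* (vx :^ 2) :* (vc :^ 2))) :+ (con (+ 1) :* (vx :^ 2) :* (vc :^ 2) :* vs)) :+ (con (Z.- (+ 3)) :* (vx :^ 2) :* (vc :^ 3))) :+ (con (Z.-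 (+ 1)) :* (vx :^ 2) :* (vc :^ 3) :* vs)) :+ (con (Z.- (+ 2)) :* (vx :^ 3) :* (vc :^ 3))) :+ (con (+ 2) :* (vx :^ 3) :* (vc :^ 4))) , relS) ∷
      (((((((((((con (+ 1) :* vx :* (vs :^ 2)) :+ (con (Z.- (+ 1)) :* vx :* vh :* (vs :^ 2))) :+ (con (Z.- (+ 1)) :* vx :* vc :* (vs :^ 2))) :+ (con (+ 2) :* (vx :^ 2) :* vc :* vs)) :+ (con (Z.- (+ 2)) :* (vx :^ 2) :* vc :* vh :* vs)) :+ (con (Z.- (+ 4)) :* (vx :^ 2) :* (vc :^ 2) :* vs)) :+ (con (Z.- (+ 1)) :* (vx :^ 2) :* (vc :^ 2) :* (vs :^ 2))) :+ (con (+ 2) :* (vx :^ 3) :* (vc :^ 2))) :+ (con (Z.- (+ 2)) :* (vx :^ 3) :* (vc :^ 2) :* vh)) :+ (con (Z.- (+ 2)) :* (vx :^ 3) :* (vc :^ 3))) , relH) ∷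
      ((((((((con (Z.- (+ 1)) :* vx) :+ (con (Z.- (+ 1)) :* vx :* vc)) :+ (con (+ 6) :* (vx :^ 2))) :+ (con (Z.- (+ 4)) :* (vx :^ 2) :* vc)) :+ (con (Z.- (+ 2)) :* (vx :^ 2) :* (vc :^ 2))) :+ (con (Z.- (+ 4)) :* (vx :^ 3) :* (vc :^ 2))) :+ (con (+ 4) :* (vx :^ 3) :* (vc :^ 3))) , relC) ∷
      []

    sc2-lhs sc2-rhs : Polynomial 10
    sc2-lhs = vsc :* ((con (Z.- 1ℤ) :+ con (+ 4) :* vx) :* vs)
    sc2-rhs = (con 1ℤ :+ con (Z.- (+ 6)) :* vx :+ con (+ 6) :* (vx :* vx)) :- (con 1ℤ :+ con (Z.- (+ 4)) :* vx) :* vs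

    sc2-identity : ⟦ sc2-lhs ⟧ (ρ s) ≈ ⟦ sc2-rhs ⟧ (ρ s)
    sc2-identity = ≈-modulo (ρ s) sc2-lhs sc2-rhs sc2-certificate ≈refl (relQ-holds ∷ relSC-holds s ∷ relV2-holds s ∷ relT-holds s ∷ relU-holds s ∷ relY-holds s ∷ relA-holds ∷ relS-holds ∷ relH-holds s ∷ relC-holds s ∷ [])

  poly-M≈ : poly (Z.- 1ℤ ∷ + 4 ∷ []) ≈ κ (Z.- 1ℤ) ⊕ κ (+ 4) ⋆ X
  poly-M≈ = mk λ { zero → refl ; (suc zero) → P.sym (P.trans (ZP.+-identityˡ _) (κ⋆ (+ 4) X 1)) ;
              (suc (suc k)) → P.sym (P.trans (ZP.+-identityˡ _) (P.trans (κ⋆ (+ 4) X (suc (suc k))) (ZP.*-zeroʳ (+ 4)))) }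

  X⋆X-vanishes : ∀ k → (X ⋆ X) (suc (suc (suc k))) ≡ 0ℤ
  X⋆X-vanishes k = X⋆-suc X (suc (suc k))

  poly-P≈ : poly (1ℤ ∷ Z.- (+ 6) ∷ + 6 ∷ []) ≈ (κ 1ℤ ⊕ κ (Z.- (+ 6)) ⋆ X) ⊕ κ (+ 6) ⋆ (X ⋆ X)
  poly-P≈ = mk λ { zero → refl
            ; (suc zero) → P.sym (P.trans (cong₂ Z._+_ (P.trans (ZP.+-identityˡ _) (κ⋆ (Z.- (+ 6)) X 1)) (P.trans (κ⋆ (+ 6) (X ⋆ X) 1) (cong (Z._*_ (+ 6)) (X⋆-suc X 0)))) refl)
            ; (suc (suc zero)) → P.sym (P.trans (cong₂ Z._+_ (P.trans (ZP.+-identityˡ _) (κ⋆ (Z.- (+ 6)) X 2)) (P.trans (κ⋆ (+ 6) (X ⋆ X) 2) (cong (Z._*_ (+ 6)) (X⋆-suc X 1)))) refl)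
            ; (suc (suc (suc k))) → P.sym (P.trans (cong₂ Z._+_ (P.trans (ZP.+-identityˡ _) (P.trans (κ⋆ (Z.- (+ 6)) X (suc (suc (suc k)))) (ZP.*-zeroʳ (Z.- (+ 6)))))
                   (P.trans (κ⋆ (+ 6) (X ⋆ X) (suc (suc (suc k)))) (P.trans (cong (Z._*_ (+ 6)) (X⋆X-vanishes k)) (ZP.*-zeroʳ (+ 6))))) refl) }

  generatingFunction : (s : Series) → IsSqrt1-4x s →
    ∀ k → (SC2 ⋆ (poly (-1ℤ ∷ + 4 ∷ []) ⋆ s)) k ≡ (poly (1ℤ ∷ Z.- (+ 6) ∷ + 6 ∷ []) ⊖ (poly (1ℤ ∷ Z.- (+ 4) ∷ []) ⋆ s)) k
  generatingFunction s (s0 , ss) k = P.trans (⋆-cong {SC2} {SC2} {poly (-1ℤ ∷ + 4 ∷ []) ⋆ s} {(κ (Z.- 1ℤ) ⊕ κ (+ 4) ⋆ X) ⋆ s} (λ _ → refl)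
       (⋆-cong {poly (-1ℤ ∷ + 4 ∷ [])} {κ (Z.- 1ℤ) ⊕ κ (+ 4) ⋆ X} {s} {s} (at poly-M≈) (λ _ → refl)) k)
    (P.trans (at (WithRoot.sc2-identity s s0 (mk ss)) k)
    (cong₂ (λ a b → a Z.+ Z.- b) (P.sym (at poly-P≈ k)) (⋆-cong {Q-in-X} {Q} {s} {s} (at (≈sym Q≈Q-in-X)) (λ _ → refl) k)))


module ClosedForm where

  open import Defs
  open PowerSeries
  open PowerSeriesRing
  open SquareRoot using (Q; module Root)
  open CentralBinomialSeries using (W; centralBinom; Q⋆∂W)
  open CentralBinomial using (centralBinomial-recurrence)
  open FunctionalEquations
  open Elimination
  open GeneratingFunction
  open import Data.Nat as N using (ℕ; zero; suc)
  open import Data.Fin using (zero; suc)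
  open import Data.Integer as Z using (ℤ; +_; 0ℤ; 1ℤ; -1ℤ)
  import Data.Integer.Properties as ZP
  open import Data.List using ([]; _∷_)
  open import Data.Vec using (Vec; []; _∷_)
  open import Data.List.Relation.Unary.All using ([]; _∷_)
  open import Relation.Binary.PropositionalEquality as numerator using (_≡_; refl; cong; cong₂)
  open import Data.Product using (_,_; _×_)
  open import Data.Integer.Tactic.RingSolver using (solve-∀)
  import Data.Nat.Tactic.RingSolver as NS
  import Data.Nat.Properties as NP
  open import Data.Nat.Combinatorics using (_C_)

  numerator : Series
  numerator = poly (1ℤ ∷ Z.- (+ 6) ∷ + 6 ∷ [])
  negQ : Series
  negQ = poly (Z.- 1ℤ ∷ + 4 ∷ [])

  s₀-0 : s₀ 0 ≡ 1ℤ
  s₀-0 = refl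

  s₀²≈Q : s₀ ⋆ s₀ ≈ Q
  s₀²≈Q = ≈trans s₀² (≈sym Q≈Q-in-X)

  open Root s₀ s₀-0 s₀²≈Q using (V; module Inverse)
  open Inverse W refl Q⋆∂W using (hV≈𝟙)

  wsc wq ws ww wp wm : Polynomial 6
  wsc = var zero
  wq = var (suc zero)
  ws = var (suc (suc zero))
  ww = var (suc (suc (suc zero)))
  wp = var (suc (suc (suc (suc zero))))
  wm = var (suc (suc (suc (suc (suc zero)))))

  ρ6 : Vec Series 6
  ρ6 = SC2 ∷ Q ∷ s₀ ∷ W ∷ numerator ∷ negQ ∷ []

  open import Relation.Binary.Reasoning.Setoid setoid

  relGF relM relW : Polynomial 6
  relGF = wsc :* (wm :* ws) :- (wp :- wq :* ws)
  relM = wm :+ wq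
  relW = ww :* (wq :* ws) :- con 1ℤ

  relGF-holds : ⟦ relGF ⟧ ρ6 ≈ 𝟘
  relGF-holds = ≈⇒difference≈𝟘 (SC2 ⋆ (negQ ⋆ s₀)) (numerator ⊕ neg (Q ⋆ s₀)) (mk (generatingFunction s₀ (s₀-0 , at s₀²≈Q)))

  relM-holds : ⟦ relM ⟧ ρ6 ≈ 𝟘
  relM-holds = mk λ { zero → refl ; (suc zero) → refl ; (suc (suc k)) → refl }

  relW-holds : ⟦ relW ⟧ ρ6 ≈ 𝟘
  relW-holds = ≈⇒difference≈𝟘 (W ⋆ V) 𝟙 hV≈𝟙

  -- With W = (1-4x)^(-3/2), whose coefficients are (2n+1) C(2n, n).
  SC2≈1-numerator⋆W : SC2 ≈ κ 1ℤ ⊕ neg (numerator ⋆ W)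
  SC2≈1-numerator⋆W = ≈-modulo ρ6 wsc (con 1ℤ :- wp :* ww) ((:- ww , relGF) ∷ (ww :* wsc :* ws , relM) ∷ (con 1ℤ :- wsc , relW) ∷ []) ≈refl (relGF-holds ∷ relM-holds ∷ relW-holds ∷ [])

  numerator⋆W-suc-suc : ∀ k → (numerator ⋆ W) (suc (suc k)) ≡ 1ℤ Z.* W (suc (suc k)) Z.+ (Z.- (+ 6) Z.* W (suc k) Z.+ + 6 Z.* W k)
  numerator⋆W-suc-suc k = numerator.trans (⋆-suc numerator W (suc k)) (cong (Z._+_ (1ℤ Z.* W (suc (suc k)))) (numerator.trans (⋆-suc (shift numerator) W k) (cong (Z._+_ (Z.- (+ 6) Z.* W (suc k))) (κ⋆ (+ 6) W k))))

  sc2-via-W : ∀ k → + sc2 (suc (suc k)) ≡ Z.- (1ℤ Z.* W (suc (suc k)) Z.+ (Z.- (+ 6) Z.* W (suc k) Z.+ + 6 Z.* W k))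
  sc2-via-W k = numerator.trans (at SC2≈1-numerator⋆W (suc (suc k))) (numerator.trans (ZP.+-identityˡ _) (cong Z.-_ (numerator⋆W-suc-suc k)))

  sc2-1 : + sc2 1 ≡ 0ℤ
  sc2-1 = at SC2≈1-numerator⋆W 1

  sc2-via-binomials : ℤ → ℤ → ℤ → ℤ → ℤ
  sc2-via-binomials K B0 B1 B2 = Z.- (1ℤ Z.* ((1ℤ Z.+ + 2 Z.* (+ 2 Z.+ K)) Z.* B2) Z.+ (Z.- (+ 6) Z.* ((1ℤ Z.+ + 2 Z.* (1ℤ Z.+ K)) Z.* B1) Z.+ + 6 Z.* ((1ℤ Z.+ + 2 Z.* K) Z.* B0)))

  closedForm-identity : ∀ K B0 B1 B2 → (1ℤ Z.+ K) Z.* B1 ≡ + 2 Z.* (+ 2 Z.* K Z.+ 1ℤ) Z.* B0 → (+ 2 Z.+ K) Z.* B2 ≡ + 2 Z.* (+ 2 Z.* (1ℤ Z.+ K) Z.+ 1ℤ) Z.* B1 →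
    (1ℤ Z.+ K) Z.* ((+ 2 Z.+ K) Z.* (sc2-via-binomials K B0 B1 B2 Z.* (+ 2 Z.* (+ 2 Z.* K Z.+ + 3))))
    ≡ (1ℤ Z.+ K) Z.* ((+ 2 Z.+ K) Z.* (B2 Z.* ((1ℤ Z.+ K) Z.* K)))
  closedForm-identity K B0 B1 B2 rec₁ rec₂ = numerator.trans (expand K B0 B1 B2)
    (numerator.trans (cong₂ (λ a b → target K B2 Z.+ α K Z.* a Z.+ β K Z.* b) (ZP.i≡j⇒i-j≡0 rec₁) (ZP.i≡j⇒i-j≡0 rec₂)) (collapse K B2))
    where
    -- α and β are the multipliers of the two recurrences, found by solving a linear system.
    α β : ℤ → ℤ
    α K = + 12 Z.* (K Z.* K Z.* K) Z.+ + 54 Z.* (K Z.* K) Z.+ + 78 Z.* K Z.+ + 36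
    β K = Z.- (+ 9 Z.* (K Z.* K Z.* K) Z.+ + 42 Z.* (K Z.* K) Z.+ + 63 Z.* K Z.+ + 30)
    target : ℤ → ℤ → ℤ
    target K B2 = (1ℤ Z.+ K) Z.* ((+ 2 Z.+ K) Z.* (B2 Z.* ((1ℤ Z.+ K) Z.* K)))
    expand : ∀ K B0 B1 B2 → (1ℤ Z.+ K) Z.* ((+ 2 Z.+ K) Z.* (Z.- (1ℤ Z.* ((1ℤ Z.+ + 2 Z.* (+ 2 Z.+ K)) Z.* B2) Z.+ (Z.- (+ 6) Z.* ((1ℤ Z.+ + 2 Z.* (1ℤ Z.+ K)) Z.* B1) Z.+ + 6 Z.* ((1ℤ Z.+ + 2 Z.* K) Z.* B0))) Z.* (+ 2 Z.* (+ 2 Z.* K Z.+ + 3))))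
      ≡ (1ℤ Z.+ K) Z.* ((+ 2 Z.+ K) Z.* (B2 Z.* ((1ℤ Z.+ K) Z.* K))) Z.+ (+ 12 Z.* (K Z.* K Z.* K) Z.+ + 54 Z.* (K Z.* K) Z.+ + 78 Z.* K Z.+ + 36) Z.* ((1ℤ Z.+ K) Z.* B1 Z.- + 2 Z.* (+ 2 Z.* K Z.+ 1ℤ) Z.* B0)
        Z.+ (Z.- (+ 9 Z.* (K Z.* K Z.* K) Z.+ + 42 Z.* (K Z.* K) Z.+ + 63 Z.* K Z.+ + 30)) Z.* ((+ 2 Z.+ K) Z.* B2 Z.- + 2 Z.* (+ 2 Z.* (1ℤ Z.+ K) Z.+ 1ℤ) Z.* B1)
    expand = solve-∀
    collapse : ∀ K B2 → (1ℤ Z.+ K) Z.* ((+ 2 Z.+ K) Z.* (B2 Z.* ((1ℤ Z.+ K) Z.* K))) Z.+ (+ 12 Z.* (K Z.* K Z.* K) Z.+ + 54 Z.* (K Z.* K) Z.+ + 78 Z.* K Z.+ + 36) Z.* 0ℤ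
        Z.+ (Z.- (+ 9 Z.* (K Z.* K Z.* K) Z.+ + 42 Z.* (K Z.* K) Z.+ + 63 Z.* K Z.+ + 30)) Z.* 0ℤ ≡ (1ℤ Z.+ K) Z.* ((+ 2 Z.+ K) Z.* (B2 Z.* ((1ℤ Z.+ K) Z.* K)))
    collapse = solve-∀

  W-coefficient : ∀ n → W n ≡ (1ℤ Z.+ + 2 Z.* + n) Z.* + centralBinom n
  W-coefficient n = numerator.trans (ZP.pos-* (2 N.* n N.+ 1) (centralBinom n)) (cong (Z._* + centralBinom n) (numerator.trans (cong +_ (NP.+-comm (2 N.* n) 1)) (numerator.trans (ZP.pos-+ 1 (2 N.* n)) (cong (Z._+_ 1ℤ) (ZP.pos-* 2 n)))))

  centralBinomial-recurrenceℤ : ∀ n → + suc n Z.* + centralBinom (suc n) ≡ + 2 Z.* (+ 2 Z.* + n Z.+ 1ℤ) Z.* + centralBinom n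
  centralBinomial-recurrenceℤ n = numerator.trans (numerator.sym (ZP.pos-* (suc n) (centralBinom (suc n)))) (numerator.trans (cong +_ (centralBinomial-recurrence n))
    (numerator.trans (ZP.pos-* (2 N.* (2 N.* n N.+ 1)) (centralBinom n)) (cong (Z._* + centralBinom n) (numerator.trans (ZP.pos-* 2 (2 N.* n N.+ 1)) (cong (Z._*_ (+ 2)) (numerator.trans (ZP.pos-+ (2 N.* n) 1) (cong (Z._+ 1ℤ) (ZP.pos-* 2 n))))))))

  closedForm : (n : ℕ) → 1 N.≤ n → sc2 n N.* (2 N.* (2 N.* n N.∸ 1)) ≡ ((2 N.* n) C n) N.* ((n N.∸ 1) N.* (n N.∸ 2))
  closedForm (suc zero) _ = cong (N._* 2) (ZP.+-injective sc2-1)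
  closedForm (suc (suc k)) _ = ZP.+-injective (ZP.*-cancelˡ-≡ (+ suc (suc k)) _ _ (ZP.*-cancelˡ-≡ (+ suc k) _ _ scaled))
    where
    K = + k
    denominator : 2 N.* (2 N.* suc (suc k) N.∸ 1) ≡ 2 N.* (2 N.* k N.+ 3)
    denominator = cong (λ m → 2 N.* (m N.∸ 1)) (double k)
      where
      double : ∀ k → 2 N.* suc (suc k) ≡ suc (2 N.* k N.+ 3)
      double = NS.solve-∀
    +denominator : + (2 N.* (2 N.* suc (suc k) N.∸ 1)) ≡ + 2 Z.* (+ 2 Z.* K Z.+ + 3)
    +denominator = numerator.trans (cong +_ denominator) (numerator.trans (ZP.pos-* 2 (2 N.* k N.+ 3)) (cong (Z._*_ (+ 2)) (numerator.trans (ZP.pos-+ (2 N.* k) 3) (cong (Z._+ + 3) (ZP.pos-* 2 k)))))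
    sc2-value : + sc2 (suc (suc k)) ≡ sc2-via-binomials K (+ centralBinom k) (+ centralBinom (suc k)) (+ centralBinom (suc (suc k)))
    sc2-value = numerator.trans (sc2-via-W k) (cong₂ (λ a c → Z.- (1ℤ Z.* a Z.+ c)) (W-coefficient (suc (suc k)))
       (cong₂ (λ a c → Z.- (+ 6) Z.* a Z.+ + 6 Z.* c) (W-coefficient (suc k)) (W-coefficient k)))
    lhs : + (sc2 (suc (suc k)) N.* (2 N.* (2 N.* suc (suc k) N.∸ 1))) ≡ sc2-via-binomials K (+ centralBinom k) (+ centralBinom (suc k)) (+ centralBinom (suc (suc k))) Z.* (+ 2 Z.* (+ 2 Z.* K Z.+ + 3))
    lhs = numerator.trans (ZP.pos-* (sc2 (suc (suc k))) _) (cong₂ Z._*_ sc2-value +denominator)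
    rhs : + (((2 N.* suc (suc k)) C suc (suc k)) N.* (suc k N.* k)) ≡ + centralBinom (suc (suc k)) Z.* ((1ℤ Z.+ K) Z.* K)
    rhs = numerator.trans (ZP.pos-* (centralBinom (suc (suc k))) (suc k N.* k)) (cong (Z._*_ (+ centralBinom (suc (suc k)))) (ZP.pos-* (suc k) k))
    scaled : + suc k Z.* (+ suc (suc k) Z.* + (sc2 (suc (suc k)) N.* (2 N.* (2 N.* suc (suc k) N.∸ 1))))
       ≡ + suc k Z.* (+ suc (suc k) Z.* + (((2 N.* suc (suc k)) C suc (suc k)) N.* (suc k N.* k)))
    scaled = numerator.trans (cong (λ z → + suc k Z.* (+ suc (suc k) Z.* z)) lhs)
         (numerator.trans (closedForm-identity K (+ centralBinom k) (+ centralBinom (suc k)) (+ centralBinom (suc (suc k))) (centralBinomial-recurrenceℤ k) (centralBinomial-recurrenceℤ (suc k)))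
         (cong (λ z → + suc k Z.* (+ suc (suc k) Z.* z)) (numerator.sym rhs)))


open import Defs
open import Data.Nat using (ℕ; _*_; _∸_; _≤_)
open import Data.Nat.Combinatorics using (_C_)
open import Data.Integer using (ℤ; +_; -_; 1ℤ; -1ℤ)
open import Data.List using ([]; _∷_)
open import Data.Product using (_×_; _,_)
open import Relation.Binary.PropositionalEquality using (_≡_)


mainTheorem3 : ((s : Series) → IsSqrt1-4x s →
    ∀ k → (SC2 ⋆ (poly (-1ℤ ∷ + 4 ∷ []) ⋆ s)) k
    ≡ (poly (1ℤ ∷ - (+ 6) ∷ + 6 ∷ []) ⊖ (poly (1ℤ ∷ - (+ 4) ∷ []) ⋆ s)) k)
    × ((n : ℕ) → 1 ≤ n →
    sc2 n * (2 * (2 * n ∸ 1)) ≡ ((2 * n) C n) * ((n ∸ 1) * (n ∸ 2)))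
mainTheorem3 = GeneratingFunction.generatingFunction , ClosedForm.closedForm
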